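{- Let $(G=(U\cup V,E),C,\mathrm{col},\ell)$ be an instance of \textsc{MoV Fair Matching} in which $G$ is a complete bipartite graph, with $n=|U|$, $k=|V|$, $C=\{c_1,\dots,c_{|C|}\}$ ordered so that $|U_{c_i}|\ge|U_{c_{i+1}}|$ for all $i\in[1,|C|-1]$, and with the convention $|U_{c_i}|:=0$ for $i>|C|$. Then the instance is a yes-instance if and only if $|U_{c_1}|\le \ell k+\sum_{i\in[k]}|U_{c_{i+1}}|$. With the non-emptiness constraint, the instance is a yes-instance if and only if it satisfies $|U_{c_1}|\le \ell k+\sum_{i\in[k]}|U_{c_{i+1}}|$ and additionally either ($\ell>0$ and $n\ge k$) or ($\ell=0$ and $n\ge 2k$).
   Context: For a bipartite graph $G=(U\cup V,E)$ with left side $U$ and right side $V$, a vertex $w$ and $M\subseteq E$, let $M(w)=\{w' \mid \{w,w'\}\in M\}$. A many-to-one matching is a set $M\subseteq E$ with $|M(u)|\le 1$ for every $u\in U$; it is left-perfect if $|M(u)|=1$ for every $u\in U$. Let $C$ be a finite set of colors and $\mathrm{col}\colon U\to C$; for $U'\subseteq U$ and $c\in C$ let $U'_c=\{u\in U'\mid \mathrm{col}(u)=c\}$. $\mathrm{MoV}(U')$ is the largest value minus the second largest value in the list $(|U'_c|)_{c\in C}$ (counted with multiplicity; absent colors count $0$). For an integer $\ell\ge0$, $U'$ is $\ell$-fair if $\mathrm{MoV}(U')\le\ell$, and $M$ is $\ell$-fair if $M(v)$ is $\ell$-fair for every $v\in V$. An instance $(G,C,\mathrm{col},\ell)$ of \textsc{MoV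 Fair Matching} is a yes-instance if there is an $\ell$-fair left-perfect many-to-one matching in $G$; with the non-emptiness constraint one additionally requires $M(v)\neq\emptyset$ for every $v\in V$. $[k]=\{1,\dots,k\}$. -}

module Defs where

open import Data.Nat using (ℕ; zero; suc; _+_; _*_; _∸_; _≤_; _<_; _≤ᵇ_)
open import Data.Nat.Properties using (_<?_)
open import Data.Fin using (Fin; toℕ; fromℕ<)
open import Data.Fin.Properties using (_≟_)
open import Data.List using (List; []; _∷_; length; filter; map; foldr)
open import Data.List.Base using (allFin)
open import Data.Bool using (if_then_else_)
open import Data.Product using (Σ; ∃; _×_; _,_)
open import Relation.Nullary.Decidable using (_×-dec_; yes; no)
open import Relation.Binary.PropositionalEquality using (_≡_)

BipGraph : ℕ → ℕ → Set₁
BipGraph n k = Fin n → Fin k → Set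

IsCompleteBipartite : ∀ {n k} → BipGraph n k → Set
IsCompleteBipartite {n} {k} E = (u : Fin n) (v : Fin k) → E u v

-- A left-perfect many-to-one matching M ⊆ E: every u has exactly one
-- partner, i.e. M is the graph of a function assign : U → V whose
-- pairs are edges of G.
record LeftPerfectMatching {n k} (E : BipGraph n k) : Set where
  field
    assign : Fin n → Fin k
    inE    : (u : Fin n) → E u (assign u)
open LeftPerfectMatching public

countMc : ∀ {n k m} → (Fin n → Fin k) → (Fin n → Fin m) → Fin k → Fin m → ℕ
countMc σ col v c =
  length (filter (λ u → (σ u ≟ v) ×-dec (col u ≟ c)) (allFin _))

countU : ∀ {n m} → (Fin n → Fin m) → Fin m → ℕ
countU col c = length (filter (λ u → col u ≟ c) (allFin _))

-- largest and second largest element of a list of naturals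
-- (counted with multiplicity; missing entries count as 0)
top2 : List ℕ → ℕ × ℕ
top2 = foldr step (0 , 0)
  where
  step : ℕ → ℕ × ℕ → ℕ × ℕ
  step x (a , b) =
    if a ≤ᵇ x then (x , a) else (if b ≤ᵇ x then (a , x) else (a , b))

MoVList : List ℕ → ℕ
MoVList xs with top2 xs
... | (a , b) = a ∸ b

MoV : ∀ {n k m} → (Fin n → Fin k) → (Fin n → Fin m) → Fin k → ℕ
MoV σ col v = MoVList (map (countMc σ col v) (allFin _))

IsFair : ∀ {n k m} → ℕ → (Fin n → Fin k) → (Fin n → Fin m) → Set
IsFair {k = k} ℓ σ col = (v : Fin k) → MoV σ col v ≤ ℓ

YesInstance : ∀ {n k m} → BipGraph n k → (Fin n → Fin m) → ℕ → Set
YesInstance E col ℓ = Σ (LeftPerfectMatching E) λ M → IsFair ℓ (assign M) col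

YesInstanceNE : ∀ {n k m} → BipGraph n k → (Fin n → Fin m) → ℕ → Set
YesInstanceNE {n} {k} E col ℓ =
  Σ (LeftPerfectMatching E) λ M → IsFair ℓ (assign M) col ×
    ((v : Fin k) → ∃ λ (u : Fin n) → assign M u ≡ v)

-- Colour ordering c_1,…,c_m given by π : Fin m → Fin m (0-based: c_{i+1} = π i).
-- Padded colour size: a i = |U_{c_{i+1}}| if i < m, and 0 otherwise.
paddedSize : ∀ {n m} → (Fin n → Fin m) → (Fin m → Fin m) → ℕ → ℕ
paddedSize {m = m} col π i with i <? m
... | yes i<m = countU col (π (fromℕ< i<m))
... | no _ = 0

sumTo : (ℕ → ℕ) → ℕ → ℕ
sumTo a zero = 0
sumTo a (suc j) = sumTo a j + a (suc j)

FairCond : ∀ {n m} → (Fin n → Fin m) → (Fin m → Fin m) → ℕ → ℕ → Set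
FairCond col π ℓ k = paddedSize col π 0 ≤ ℓ * k + sumTo (paddedSize col π) k

-- A matching of the complete graph is determined, up to the order of items, by its count
-- matrix N v c = |M(v)_c|: the column sums are the colour sizes |U_c| and the matching is
-- ℓ-fair iff every row is, and conversely every such matrix is realised by a matching.
-- Necessity: in each bin the count of c₁ exceeds the runner-up by at most ℓ, and the runner-up
-- is another colour, so it is at most t plus its excess over t, where t = |U_{c_{k+2}}|.
-- Summing over the k bins bounds |U_{c₁}| by k(ℓ + t) plus the total excess over t, and only
-- c₂, …, c_{k+1} have any excess.
-- Sufficiency: bin s takes min(ℓ + |U_{c_{s+2}}|, r) items of c₁ and min(|U_{c_{s+2}}|, r) of
-- c_{s+2}, where r is what is left of c₁, and bin 0 takes everything else; the condition says
-- exactly that c₁ is used up by the k bins.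
-- Non-emptiness: empty bins are filled one at a time from bins with spare items. For ℓ > 0 a
-- bin with two items gives away one item of a largest colour. For ℓ = 0 every nonempty bin is
-- tied, hence has at least two items; a bin with four items gives away a tied part, two bins
-- with three items give one item each, of distinct colours, and otherwise n < 2k.
module Submission where

open import Defs

open import Data.Bool using (Bool; true; false; if_then_else_; _∧_; T)
open import Data.Bool.Properties using (∧-comm; ∧-identityʳ)
open import Data.Fin using (Fin; zero; suc; toℕ; fromℕ<)
open import Data.Fin.Permutation using (Permutation′; _⟨$⟩ʳ_; _⟨$⟩ˡ_; inverseˡ; inverseʳ)
open import Data.Fin.Properties using (_≟_; any?; suc-injective; toℕ<n; fromℕ<-toℕ; toℕ-fromℕ<)
open import Data.List using (List; []; _∷_; tabulate; length; filter; allFin)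
open import Data.List.Membership.Propositional.Properties using (∈-allFin)
open import Data.List.Properties using (tabulate-cong; map-tabulate)
open import Data.List.Relation.Unary.All as All using (All; []; _∷_)
open import Data.Nat using (ℕ; zero; suc; _+_; _*_; _∸_; _⊓_; _≤_; _<_; z≤n; s≤s; z<s; _≤ᵇ_)
open import Data.Nat.Properties hiding (_≟_; suc-injective)
open import Data.Nat.Properties using () renaming (_≟_ to _≟ℕ_)
import Data.Nat.Properties as NatP
open import Data.Nat.Solver using (module +-*-Solver)
open import Data.Product using (∃; ∃₂; _×_; _,_; proj₁; proj₂)
open import Data.Sum using (_⊎_; inj₁; inj₂)
open import Data.Unit using (tt)
open import Function.Bundles using (_⇔_; mk⇔)
open import Relation.Binary.PropositionalEquality
  using (_≡_; _≢_; refl; sym; trans; cong; cong₂; subst; subst₂; module ≡-Reasoning)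
open import Relation.Nullary using (¬?; Dec; yes; no; does; contradiction)
open import Relation.Nullary.Decidable using (_×-dec_; dec-true; dec-false)
open import Relation.Unary using (Pred; Decidable)
open import Algebra.Properties.CommutativeMonoid.Sum +-0-commutativeMonoid
  using (sum; sum-cong-≗; sum-replicate-zero; ∑-comm; ∑-distrib-+)

⟦_⟧ : Bool → ℕ
⟦ true ⟧ = 1
⟦ false ⟧ = 0

[_↦_] : ∀ {n} → Fin n → ℕ → Fin n → ℕ
[ j ↦ x ] i = if does (j ≟ i) then x else 0

[↦]-self : ∀ {n} (j : Fin n) x → [ j ↦ x ] j ≡ x
[↦]-self j x = cong (if_then x else 0) (dec-true (j ≟ j) refl)

[↦]-≢ : ∀ {n} {i j : Fin n} x → j ≢ i → [ j ↦ x ] i ≡ 0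
[↦]-≢ {i = i} {j} x j≢i = cong (if_then x else 0) (dec-false (j ≟ i) j≢i)

[↦]-bounded : ∀ {n} (j : Fin n) {x} i → [ j ↦ x ] i ≤ x
[↦]-bounded j i with does (j ≟ i)
... | true = ≤-refl
... | false = z≤n

[↦]-below : ∀ {n} {f : Fin n → ℕ} j {x} → x ≤ f j → ∀ i → [ j ↦ x ] i ≤ f i
[↦]-below j x≤fj i with j ≟ i
... | yes refl = x≤fj
... | no _ = z≤n

sum-mono-≤ : ∀ {n} {f g : Fin n → ℕ} → (∀ i → f i ≤ g i) → sum f ≤ sum g
sum-mono-≤ {zero} f≤g = z≤n
sum-mono-≤ {suc n} f≤g = +-mono-≤ (f≤g zero) (sum-mono-≤ (λ i → f≤g (suc i)))

sum-const : ∀ n x → sum {n} (λ _ → x) ≡ n * x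
sum-const zero x = refl
sum-const (suc n) x = cong (x +_) (sum-const n x)

term≤sum : ∀ {n} (f : Fin n → ℕ) i → f i ≤ sum f
term≤sum f zero = m≤m+n _ _
term≤sum f (suc i) = ≤-trans (term≤sum (λ j → f (suc j)) i) (m≤n+m _ _)

two-terms≤sum : ∀ {n} (f : Fin n → ℕ) {i j} → i ≢ j → f i + f j ≤ sum f
two-terms≤sum f {zero} {zero} 0≢0 = contradiction refl 0≢0
two-terms≤sum f {zero} {suc j} _ = +-monoʳ-≤ (f zero) (term≤sum (λ j → f (suc j)) j)
two-terms≤sum f {suc i} {zero} _ =
  ≤-trans (≤-reflexive (+-comm (f (suc i)) (f zero))) (+-monoʳ-≤ (f zero) (term≤sum (λ j → f (suc j)) i))
two-terms≤sum f {suc i} {suc j} i≢j =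
  ≤-trans (two-terms≤sum (λ j → f (suc j)) (λ i≡j → i≢j (cong suc i≡j))) (m≤n+m _ _)

sum-[↦] : ∀ {n} (j : Fin n) x → sum [ j ↦ x ] ≡ x
sum-[↦] {suc n} zero x = trans (cong (x +_) (sum-replicate-zero n)) (+-identityʳ x)
sum-[↦] (suc j) x = sum-[↦] j x

sum-∸ : ∀ {n} (f g : Fin n → ℕ) → (∀ i → g i ≤ f i) → sum (λ i → f i ∸ g i) + sum g ≡ sum f
sum-∸ f g g≤f = trans (sym (∑-distrib-+ (λ i → f i ∸ g i) g)) (sum-cong-≗ (λ i → m∸n+n≡m (g≤f i)))

∸-superadditive : ∀ x y t → (x ∸ t) + (y ∸ t) ≤ (x + y) ∸ t
∸-superadditive x y t with x ≤? t | y ≤? t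
... | yes x≤t | _ = begin
  (x ∸ t) + (y ∸ t) ≡⟨ cong (_+ (y ∸ t)) (m≤n⇒m∸n≡0 x≤t) ⟩
  y ∸ t             ≤⟨ ∸-monoˡ-≤ t (m≤n+m y x) ⟩
  (x + y) ∸ t       ∎
  where open ≤-Reasoning
... | no _ | yes y≤t = begin
  (x ∸ t) + (y ∸ t) ≡⟨ trans (cong ((x ∸ t) +_) (m≤n⇒m∸n≡0 y≤t)) (+-identityʳ _) ⟩
  x ∸ t             ≤⟨ ∸-monoˡ-≤ t (m≤m+n x y) ⟩
  (x + y) ∸ t       ∎
  where open ≤-Reasoning
... | no x≰t | no _ = begin
  (x ∸ t) + (y ∸ t) ≤⟨ +-monoʳ-≤ (x ∸ t) (m∸n≤m y t) ⟩
  (x ∸ t) + y       ≡⟨ sym (+-∸-comm y (<⇒≤ (≰⇒> x≰t))) ⟩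
  (x + y) ∸ t       ∎
  where open ≤-Reasoning

sum-∸-const : ∀ {n} (f : Fin n → ℕ) t → sum (λ i → f i ∸ t) ≤ sum f ∸ t
sum-∸-const {zero} f t = z≤n
sum-∸-const {suc n} f t = ≤-trans
  (+-monoʳ-≤ (f zero ∸ t) (sum-∸-const (λ i → f (suc i)) t))
  (∸-superadditive (f zero) _ t)

positive-term : ∀ {n} (f : Fin n → ℕ) → 1 ≤ sum f → ∃ λ i → 1 ≤ f i
positive-term {suc n} f 1≤Σf with f zero in f0 | 1≤Σf
... | suc _ | _ = zero , ≤-trans (s≤s z≤n) (≤-reflexive (sym f0))
... | zero | 1≤Σtail with positive-term (λ i → f (suc i)) 1≤Σtail
...   | i , 1≤fi = suc i , 1≤fi

two-ones : ∀ {n} (f : Fin n → ℕ) → (∀ i → f i ≤ 1) → 2 ≤ sum f →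
           ∃₂ λ p q → p ≢ q × f p ≡ 1 × f q ≡ 1
two-ones {suc n} f f≤1 2≤Σf with f zero in f0 | f≤1 zero | 2≤Σf
... | 1 | _ | s≤s 1≤Σtail with positive-term (λ i → f (suc i)) 1≤Σtail
...   | i , 1≤fi = zero , suc i , (λ ()) , f0 , ≤-antisym (f≤1 (suc i)) 1≤fi
two-ones {suc n} f f≤1 2≤Σf | 0 | _ | 2≤Σtail
  with two-ones (λ i → f (suc i)) (λ i → f≤1 (suc i)) 2≤Σtail
...   | p , q , p≢q , fp , fq = suc p , suc q , (λ e → p≢q (suc-injective e)) , fp , fq
two-ones {suc n} f f≤1 2≤Σf | suc (suc _) | s≤s () | _

sum-⟦≟∧⟧ : ∀ {n} (j : Fin n) b → sum (λ v → ⟦ does (j ≟ v) ∧ b ⟧) ≡ ⟦ b ⟧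
sum-⟦≟∧⟧ j b = trans (sum-cong-≗ ⟦≟∧⟧≡[↦]) (sum-[↦] j ⟦ b ⟧)
  where
  ⟦≟∧⟧≡[↦] : ∀ v → ⟦ does (j ≟ v) ∧ b ⟧ ≡ [ j ↦ ⟦ b ⟧ ] v
  ⟦≟∧⟧≡[↦] v with does (j ≟ v)
  ... | true = refl
  ... | false = refl

top second mov : ∀ {m} → (Fin m → ℕ) → ℕ
top f = proj₁ (top2 (tabulate f))
second f = proj₂ (top2 (tabulate f))
mov f = top f ∸ second f

record IsTopTwo {m} (f : Fin (suc m) → ℕ) (a b : ℕ) : Set where
  field
    argmax : Fin (suc m)
    f-argmax : f argmax ≡ a
    ≤-second : ∀ j → j ≢ argmax → f j ≤ b
    b≤a : b ≤ a
    second-attained : b ≡ 0 ⊎ ∃ λ j → j ≢ argmax × f j ≡ b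

module _ {m} (f : Fin (suc (suc m)) → ℕ) {a b} (tail : IsTopTwo (λ i → f (suc i)) a b) where
  open IsTopTwo tail

  isTopTwo-newTop : a ≤ f zero → IsTopTwo f (f zero) a
  isTopTwo-newTop a≤x = record
    { argmax = zero ; f-argmax = refl ; ≤-second = ≤a ; b≤a = a≤x
    ; second-attained = inj₂ (suc argmax , (λ ()) , f-argmax) }
    where
    ≤a : ∀ j → j ≢ zero → f j ≤ a
    ≤a zero 0≢0 = contradiction refl 0≢0
    ≤a (suc j) _ with j ≟ argmax
    ... | yes refl = ≤-reflexive f-argmax
    ... | no j≢i = ≤-trans (≤-second j j≢i) b≤a

  isTopTwo-newSecond : f zero < a → b ≤ f zero → IsTopTwo f a (f zero)
  isTopTwo-newSecond x<a b≤x = record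
    { argmax = suc argmax ; f-argmax = f-argmax ; ≤-second = ≤x ; b≤a = <⇒≤ x<a
    ; second-attained = inj₂ (zero , (λ ()) , refl) }
    where
    ≤x : ∀ j → j ≢ suc argmax → f j ≤ f zero
    ≤x zero _ = ≤-refl
    ≤x (suc j) j≢i = ≤-trans (≤-second j (λ e → j≢i (cong suc e))) b≤x

  isTopTwo-unchanged : f zero < b → IsTopTwo f a b
  isTopTwo-unchanged x<b = record
    { argmax = suc argmax ; f-argmax = f-argmax ; ≤-second = ≤b ; b≤a = b≤a
    ; second-attained = shifted second-attained }
    where
    ≤b : ∀ j → j ≢ suc argmax → f j ≤ b
    ≤b zero _ = <⇒≤ x<b
    ≤b (suc j) j≢i = ≤-second j (λ e → j≢i (cong suc e))
    shifted : (b ≡ 0 ⊎ ∃ λ j → j ≢ argmax × f (suc j) ≡ b) → b ≡ 0 ⊎ ∃ λ j → j ≢ suc argmax × f j ≡ b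
    shifted (inj₁ b≡0) = inj₁ b≡0
    shifted (inj₂ (j , j≢i , fj)) = inj₂ (suc j , (λ e → j≢i (suc-injective e)) , fj)

top2-isTopTwo : ∀ {m} (f : Fin (suc m) → ℕ) → IsTopTwo f (top f) (second f)
top2-isTopTwo {zero} f = record
  { argmax = zero ; f-argmax = refl ; ≤-second = λ { zero 0≢0 → contradiction refl 0≢0 }
  ; b≤a = z≤n ; second-attained = inj₁ refl }
top2-isTopTwo {suc m} f with top2 (tabulate (λ i → f (suc i))) | top2-isTopTwo (λ i → f (suc i))
... | (a , b) | tail with a ≤ᵇ f zero in a≤ᵇx
... | true = isTopTwo-newTop f tail (≤ᵇ⇒≤ a (f zero) (subst T (sym a≤ᵇx) tt))
... | false with b ≤ᵇ f zero in b≤ᵇx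
...   | true = isTopTwo-newSecond f tail (≰⇒> (λ a≤x → subst T a≤ᵇx (≤⇒≤ᵇ a≤x))) (≤ᵇ⇒≤ b (f zero) (subst T (sym b≤ᵇx) tt))
...   | false = isTopTwo-unchanged f tail (≰⇒> (λ b≤x → subst T b≤ᵇx (≤⇒≤ᵇ b≤x)))

module TopTwo {m} (f : Fin (suc m) → ℕ) = IsTopTwo (top2-isTopTwo f)

≤top : ∀ {m} (f : Fin m → ℕ) c → f c ≤ top f
≤top {suc m} f c with c ≟ TopTwo.argmax f
... | yes refl = ≤-reflexive (TopTwo.f-argmax f)
... | no c≢i = ≤-trans (TopTwo.≤-second f c c≢i) (TopTwo.b≤a f)

top-least : ∀ {m} (f : Fin m → ℕ) {K} → (∀ c → f c ≤ K) → top f ≤ K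
top-least {zero} f _ = z≤n
top-least {suc m} f f≤K = subst (_≤ _) (TopTwo.f-argmax f) (f≤K (TopTwo.argmax f))

second≤top : ∀ {m} (f : Fin m → ℕ) → second f ≤ top f
second≤top {zero} f = z≤n
second≤top {suc m} f = TopTwo.b≤a f

≤second : ∀ {m} (f : Fin m → ℕ) {p q} → p ≢ q → f q ≤ f p → f q ≤ second f
≤second {suc m} f {p} {q} p≢q fq≤fp with q ≟ TopTwo.argmax f
... | yes refl = ≤-trans fq≤fp (TopTwo.≤-second f p p≢q)
... | no q≢i = TopTwo.≤-second f q q≢i

second-attained-off : ∀ {m} (f : Fin m → ℕ) c → second f ≡ 0 ⊎ ∃ λ d → d ≢ c × second f ≤ f d
second-attained-off {zero} f c = inj₁ refl
second-attained-off {suc m} f c with TopTwo.second-attained f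
... | inj₁ b≡0 = inj₁ b≡0
... | inj₂ (j , j≢i , fj) with TopTwo.argmax f ≟ c
...   | yes refl = inj₂ (j , j≢i , ≤-reflexive (sym fj))
...   | no i≢c = inj₂ (TopTwo.argmax f , i≢c , ≤-trans (TopTwo.b≤a f) (≤-reflexive (sym (TopTwo.f-argmax f))))

top+second≤sum : ∀ {m} (f : Fin m → ℕ) → top f + second f ≤ sum f
top+second≤sum {zero} f = z≤n
top+second≤sum {suc m} f with TopTwo.second-attained f
... | inj₁ b≡0 = begin
  top f + second f       ≡⟨ trans (cong (top f +_) b≡0) (+-identityʳ _) ⟩
  top f                  ≡⟨ sym (TopTwo.f-argmax f) ⟩
  f (TopTwo.argmax f)    ≤⟨ term≤sum f _ ⟩
  sum f                  ∎
  where open ≤-Reasoning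
... | inj₂ (j , j≢i , fj) =
  subst (_≤ sum f) (cong₂ _+_ (TopTwo.f-argmax f) fj) (two-terms≤sum f (λ i≡j → j≢i (sym i≡j)))

mov-cong : ∀ {m} {f g : Fin m → ℕ} → (∀ c → f c ≡ g c) → mov f ≡ mov g
mov-cong f≗g = cong (λ xs → proj₁ (top2 xs) ∸ proj₂ (top2 xs)) (tabulate-cong f≗g)

mov-≤-bounded : ∀ {m} (f : Fin m → ℕ) {ℓ} → (∀ c → f c ≤ ℓ) → mov f ≤ ℓ
mov-≤-bounded f f≤ℓ = ≤-trans (m∸n≤m (top f) (second f)) (top-least f f≤ℓ)

mov-≤-runnerUp : ∀ {m} (f : Fin m → ℕ) {ℓ p q} → p ≢ q → f q ≤ f p → (∀ c → f c ≤ f q + ℓ) → mov f ≤ ℓ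
mov-≤-runnerUp f {ℓ} {p} {q} p≢q fq≤fp f≤fq+ℓ = begin
  top f ∸ second f ≤⟨ ∸-monoʳ-≤ (top f) (≤second f p≢q fq≤fp) ⟩
  top f ∸ f q      ≤⟨ ∸-monoˡ-≤ (f q) (top-least f f≤fq+ℓ) ⟩
  f q + ℓ ∸ f q    ≡⟨ m+n∸m≡n (f q) ℓ ⟩
  ℓ                ∎
  where open ≤-Reasoning

top≤second+ℓ : ∀ {m} (f : Fin m → ℕ) {ℓ} → mov f ≤ ℓ → top f ≤ second f + ℓ
top≤second+ℓ f {ℓ} mov≤ℓ = begin
  top f                     ≡⟨ sym (m∸n+n≡m (second≤top f)) ⟩
  (top f ∸ second f) + second f ≤⟨ +-monoˡ-≤ (second f) mov≤ℓ ⟩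
  ℓ + second f              ≡⟨ +-comm ℓ (second f) ⟩
  second f + ℓ              ∎
  where open ≤-Reasoning

length-filter-tabulate : ∀ {a p} {A : Set a} {P : Pred A p} (P? : Decidable P) {n} (f : Fin n → A) →
  length (filter P? (tabulate f)) ≡ sum (λ i → ⟦ does (P? (f i)) ⟧)
length-filter-tabulate P? {zero} f = refl
length-filter-tabulate P? {suc n} f with does (P? (f zero))
... | true = cong suc (length-filter-tabulate P? (λ i → f (suc i)))
... | false = length-filter-tabulate P? (λ i → f (suc i))

countMc-sum : ∀ {n k m} (σ : Fin n → Fin k) (col : Fin n → Fin m) v c →
  countMc σ col v c ≡ sum (λ u → ⟦ does (σ u ≟ v) ∧ does (col u ≟ c) ⟧)
countMc-sum σ col v c = length-filter-tabulate (λ u → (σ u ≟ v) ×-dec (col u ≟ c)) (λ u → u)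

countU-sum : ∀ {n m} (col : Fin n → Fin m) c → countU col c ≡ sum (λ u → ⟦ does (col u ≟ c) ⟧)
countU-sum col c = length-filter-tabulate (λ u → col u ≟ c) (λ u → u)

MoV≡mov : ∀ {n k m} (σ : Fin n → Fin k) (col : Fin n → Fin m) v → MoV σ col v ≡ mov (countMc σ col v)
MoV≡mov {m = m} σ col v =
  cong (λ xs → proj₁ (top2 xs) ∸ proj₂ (top2 xs)) (map-tabulate {n = m} (λ c → c) (countMc σ col v))

Matrix : ℕ → ℕ → Set
Matrix k m = Fin k → Fin m → ℕ

HasColumnSums : ∀ {n k m} → (Fin n → Fin m) → Matrix k m → Set
HasColumnSums col N = ∀ c → sum (λ v → N v c) ≡ countU col c

HasFairRows : ∀ {k m} → ℕ → Matrix k m → Set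
HasFairRows ℓ N = ∀ v → mov (N v) ≤ ℓ

record IsFairMatrix {n k m} (col : Fin n → Fin m) (ℓ : ℕ) (N : Matrix k m) : Set where
  field
    columnSums : HasColumnSums col N
    fairRows : HasFairRows ℓ N

countMc-columnSums : ∀ {n k m} (σ : Fin n → Fin k) (col : Fin n → Fin m) → HasColumnSums col (countMc σ col)
countMc-columnSums σ col c = begin
  sum (λ v → countMc σ col v c)                                  ≡⟨ sum-cong-≗ (λ v → countMc-sum σ col v c) ⟩
  sum (λ v → sum (λ u → ⟦ does (σ u ≟ v) ∧ does (col u ≟ c) ⟧)) ≡⟨ ∑-comm (λ v u → ⟦ does (σ u ≟ v) ∧ does (col u ≟ c) ⟧) ⟩
  sum (λ u → sum (λ v → ⟦ does (σ u ≟ v) ∧ does (col u ≟ c) ⟧)) ≡⟨ sum-cong-≗ (λ u → sum-⟦≟∧⟧ (σ u) (does (col u ≟ c))) ⟩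
  sum (λ u → ⟦ does (col u ≟ c) ⟧)                              ≡⟨ sym (countU-sum col c) ⟩
  countU col c                                                   ∎
  where open ≡-Reasoning

countMc-rowSum : ∀ {n k m} (σ : Fin n → Fin k) (col : Fin n → Fin m) v →
  sum (countMc σ col v) ≡ sum (λ u → ⟦ does (σ u ≟ v) ⟧)
countMc-rowSum {m = m} σ col v = begin
  sum (countMc σ col v)                                          ≡⟨ sum-cong-≗ (λ c → countMc-sum σ col v c) ⟩
  sum (λ c → sum (λ u → ⟦ does (σ u ≟ v) ∧ does (col u ≟ c) ⟧)) ≡⟨ ∑-comm (λ c u → ⟦ does (σ u ≟ v) ∧ does (col u ≟ c) ⟧) ⟩
  sum (λ u → sum (λ c → ⟦ does (σ u ≟ v) ∧ does (col u ≟ c) ⟧)) ≡⟨ sum-cong-≗ (λ u → sum-cong-≗ {m} (λ c → cong ⟦_⟧ (∧-comm (does (σ u ≟ v)) _))) ⟩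
  sum (λ u → sum (λ c → ⟦ does (col u ≟ c) ∧ does (σ u ≟ v) ⟧)) ≡⟨ sum-cong-≗ (λ u → sum-⟦≟∧⟧ (col u) (does (σ u ≟ v))) ⟩
  sum (λ u → ⟦ does (σ u ≟ v) ⟧)                                ∎
  where open ≡-Reasoning

countU-total : ∀ {n m} (col : Fin n → Fin m) → sum (countU col) ≡ n
countU-total {n} {m} col = begin
  sum (countU col)                                      ≡⟨ sum-cong-≗ (countU-sum col) ⟩
  sum (λ c → sum (λ u → ⟦ does (col u ≟ c) ⟧))          ≡⟨ ∑-comm (λ c u → ⟦ does (col u ≟ c) ⟧) ⟩
  sum (λ u → sum (λ c → ⟦ does (col u ≟ c) ⟧))          ≡⟨ sum-cong-≗ (λ u → sum-cong-≗ {m} (λ c → cong ⟦_⟧ (sym (∧-identityʳ (does (col u ≟ c)))))) ⟩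
  sum (λ u → sum (λ c → ⟦ does (col u ≟ c) ∧ true ⟧))   ≡⟨ sum-cong-≗ (λ u → sum-⟦≟∧⟧ (col u) true) ⟩
  sum {n} (λ _ → 1)                                     ≡⟨ trans (sum-const n 1) (*-identityʳ n) ⟩
  n                                                     ∎
  where open ≡-Reasoning

entries-total : ∀ {n k m} {col : Fin n → Fin m} (N : Matrix k m) → HasColumnSums col N →
  sum (λ v → sum (N v)) ≡ n
entries-total {col = col} N colSums = trans (∑-comm N) (trans (sum-cong-≗ colSums) (countU-total col))

item : ∀ {k m} → Fin k → Fin m → Matrix k m
item v₀ c₀ v c = ⟦ does (v₀ ≟ v) ∧ does (c₀ ≟ c) ⟧

item≤ : ∀ {k m} (N : Matrix k m) {v₀ c₀} → 1 ≤ N v₀ c₀ → ∀ v c → item v₀ c₀ v c ≤ N v c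
item≤ N {v₀} {c₀} 1≤N v c with v₀ ≟ v | c₀ ≟ c
... | yes refl | yes refl = 1≤N
... | yes _ | no _ = z≤n
... | no _ | _ = z≤n

countMc-suc : ∀ {n k m} (σ : Fin (suc n) → Fin k) (col : Fin (suc n) → Fin m) v c →
  countMc σ col v c ≡ item (σ zero) (col zero) v c + countMc (λ u → σ (suc u)) (λ u → col (suc u)) v c
countMc-suc σ col v c =
  trans (countMc-sum σ col v c) (cong (item (σ zero) (col zero) v c +_) (sym (countMc-sum _ (λ u → col (suc u)) v c)))

countU-suc : ∀ {n m} (col : Fin (suc n) → Fin m) c → countU col c ≡ ⟦ does (col zero ≟ c) ⟧ + countU (λ u → col (suc u)) c
countU-suc col c = trans (countU-sum col c) (cong (⟦ does (col zero ≟ c) ⟧ +_) (sym (countU-sum (λ u → col (suc u)) c)))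

module _ {n k m} (col : Fin (suc n) → Fin m) (N : Matrix k m) (colSums : HasColumnSums col N) where

  host-bin : ∃ λ v → 1 ≤ N v (col zero)
  host-bin = positive-term (λ v → N v (col zero))
    (subst (1 ≤_) (sym (trans (colSums (col zero)) (countU-suc col (col zero))))
      (subst (λ b → 1 ≤ ⟦ b ⟧ + countU (λ u → col (suc u)) (col zero)) (sym (dec-true (col zero ≟ col zero) refl)) (s≤s z≤n)))

  columnSums-minus-item : ∀ {v₀} → 1 ≤ N v₀ (col zero) →
    HasColumnSums (λ u → col (suc u)) (λ v c → N v c ∸ item v₀ (col zero) v c)
  columnSums-minus-item {v₀} 1≤N c = begin
    sum (λ v → N v c ∸ item₀ v c)                      ≡⟨ sym (m+n∸n≡m _ (sum (λ v → item₀ v c))) ⟩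
    sum (λ v → N v c ∸ item₀ v c) + sum (λ v → item₀ v c) ∸ sum (λ v → item₀ v c)
                                                       ≡⟨ cong₂ _∸_ (sum-∸ (λ v → N v c) (λ v → item₀ v c) (λ v → item≤ N 1≤N v c))
                                                                    (sum-⟦≟∧⟧ v₀ (does (col zero ≟ c))) ⟩
    sum (λ v → N v c) ∸ ⟦ does (col zero ≟ c) ⟧        ≡⟨ cong (_∸ ⟦ does (col zero ≟ c) ⟧) (trans (colSums c) (countU-suc col c)) ⟩
    ⟦ does (col zero ≟ c) ⟧ + countU (λ u → col (suc u)) c ∸ ⟦ does (col zero ≟ c) ⟧
                                                       ≡⟨ m+n∸m≡n ⟦ does (col zero ≟ c) ⟧ _ ⟩
    countU (λ u → col (suc u)) c                       ∎
    where
    open ≡-Reasoning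
    item₀ : Matrix k m
    item₀ = item v₀ (col zero)

realise : ∀ {n k m} (col : Fin n → Fin m) (N : Matrix k m) → HasColumnSums col N →
  ∃ λ (σ : Fin n → Fin k) → ∀ v c → countMc σ col v c ≡ N v c
realise {zero} col N colSums =
  (λ ()) , λ v c → sym (n≤0⇒n≡0 (≤-trans (term≤sum (λ v → N v c) v) (≤-reflexive (colSums c))))
realise {suc n} col N colSums with host-bin col N colSums
... | v₀ , 1≤N with realise (λ u → col (suc u)) _ (columnSums-minus-item col N colSums 1≤N)
...   | σ′ , σ′-counts = σ , σ-counts
  where
  σ : Fin (suc n) → _
  σ zero = v₀
  σ (suc u) = σ′ u
  σ-counts : ∀ v c → countMc σ col v c ≡ N v c
  σ-counts v c = trans (countMc-suc σ col v c)
    (trans (cong (item v₀ (col zero) v c +_) (σ′-counts v c)) (m+[n∸m]≡n (item≤ N 1≤N v c)))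

sumTo-shift : ∀ (g : ℕ → ℕ) j → sumTo g (suc j) ≡ g 1 + sumTo (λ i → g (suc i)) j
sumTo-shift g zero = +-comm 0 (g 1)
sumTo-shift g (suc j) = trans (cong (_+ g (suc (suc j))) (sumTo-shift g j)) (+-assoc (g 1) _ _)

sumTo-sum : ∀ j (g : ℕ → ℕ) → sumTo g j ≡ sum {j} (λ i → g (suc (toℕ i)))
sumTo-sum zero g = refl
sumTo-sum (suc j) g = trans (sumTo-shift g j) (cong (g 1 +_) (sumTo-sum j (λ i → g (suc i))))

sumTo-mono : ∀ (g : ℕ → ℕ) {i j} → i ≤ j → sumTo g i ≤ sumTo g j
sumTo-mono g {i} i≤j with m≤n⇒∃[o]m+o≡n i≤j
... | d , refl = extend d
  where
  extend : ∀ d → sumTo g i ≤ sumTo g (i + d)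
  extend zero = ≤-reflexive (cong (sumTo g) (sym (+-identityʳ i)))
  extend (suc d) = ≤-trans (extend d) (≤-trans (m≤m+n _ _) (≤-reflexive (cong (sumTo g) (sym (+-suc i d)))))

sumTo-≤-support : ∀ (g : ℕ → ℕ) k → (∀ i → k < i → g i ≡ 0) → ∀ j → sumTo g j ≤ sumTo g k
sumTo-≤-support g k vanish zero = z≤n
sumTo-≤-support g k vanish (suc j) with suc j ≤? k
... | yes j<k = sumTo-mono g j<k
... | no j≮k = begin
  sumTo g j + g (suc j) ≡⟨ trans (cong (sumTo g j +_) (vanish (suc j) (≰⇒> j≮k))) (+-identityʳ _) ⟩
  sumTo g j             ≤⟨ sumTo-≤-support g k vanish j ⟩
  sumTo g k             ∎
  where open ≤-Reasoning

sumTo-∸ : ∀ (g : ℕ → ℕ) t j → (∀ i → i ≤ j → t ≤ g (suc i)) →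
  j * t + sumTo (λ i → g i ∸ t) j ≡ sumTo g j
sumTo-∸ g t zero t≤g = refl
sumTo-∸ g t (suc j) t≤g = begin
  (t + j * t) + (sumTo (λ i → g i ∸ t) j + (g (suc j) ∸ t)) ≡⟨ rearrange t (j * t) _ _ ⟩
  (j * t + sumTo (λ i → g i ∸ t) j) + ((g (suc j) ∸ t) + t) ≡⟨ cong₂ _+_ (sumTo-∸ g t j (λ i i≤j → t≤g i (m≤n⇒m≤1+n i≤j)))
                                                                      (m∸n+n≡m (t≤g j (n≤1+n j))) ⟩
  sumTo g j + g (suc j)                                     ∎
  where
  open ≡-Reasoning
  rearrange : ∀ a b c d → (a + b) + (c + d) ≡ (b + c) + (d + a)
  rearrange = solve 4 (λ a b c d → (a :+ b) :+ (c :+ d) := (b :+ c) :+ (d :+ a)) refl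
    where open +-*-Solver

IsSortedBySize : ∀ {n m} → (Fin n → Fin m) → Permutation′ m → Set
IsSortedBySize {m = m} col π =
  (i j : Fin m) → toℕ j ≡ suc (toℕ i) → countU col (π ⟨$⟩ʳ j) ≤ countU col (π ⟨$⟩ʳ i)

module SortedSizes {n m : ℕ} (col : Fin n → Fin m) (π : Permutation′ m) (sorted : IsSortedBySize col π) where

  size : ℕ → ℕ
  size = paddedSize col (π ⟨$⟩ʳ_)

  size-rank : ∀ (i : Fin m) → size (toℕ i) ≡ countU col (π ⟨$⟩ʳ i)
  size-rank i with toℕ i <? m
  ... | yes i<m = cong (λ j → countU col (π ⟨$⟩ʳ j)) (fromℕ<-toℕ i i<m)
  ... | no i≮m = contradiction (toℕ<n i) i≮m

  size-beyond : ∀ i → m ≤ i → size i ≡ 0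
  size-beyond i m≤i with i <? m
  ... | yes i<m = contradiction i<m (≤⇒≯ m≤i)
  ... | no _ = refl

  size-step : ∀ i → size (suc i) ≤ size i
  size-step i with suc i <? m
  ... | no _ = z≤n
  ... | yes i+1<m with i <? m
  ...   | no i≮m = contradiction (<-trans (n<1+n i) i+1<m) i≮m
  ...   | yes i<m = sorted (fromℕ< i<m) (fromℕ< i+1<m)
                      (trans (toℕ-fromℕ< i+1<m) (cong suc (sym (toℕ-fromℕ< i<m))))

  size-antitone : ∀ {i j} → i ≤ j → size j ≤ size i
  size-antitone {i} i≤j with m≤n⇒∃[o]m+o≡n i≤j
  ... | d , refl = descend d
    where
    descend : ∀ d → size (i + d) ≤ size i
    descend zero = ≤-reflexive (cong size (+-identityʳ i))
    descend (suc d) = ≤-trans (≤-reflexive (cong size (+-suc i d))) (≤-trans (size-step (i + d)) (descend d))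

  countU-π⁻¹ : ∀ c → size (toℕ (π ⟨$⟩ˡ c)) ≡ countU col c
  countU-π⁻¹ c = trans (size-rank (π ⟨$⟩ˡ c)) (cong (countU col) (inverseʳ π))

suc-preimage : ∀ {m} (π : Permutation′ (suc m)) {d} → d ≢ π ⟨$⟩ʳ zero → ∃ λ j → π ⟨$⟩ʳ suc j ≡ d
suc-preimage π {d} d≢π0 with π ⟨$⟩ˡ d in π⁻¹d
... | zero = contradiction (trans (sym (inverseʳ π)) (cong (π ⟨$⟩ʳ_) π⁻¹d)) d≢π0
... | suc j = j , trans (cong (π ⟨$⟩ʳ_) (sym π⁻¹d)) (inverseʳ π)

second≤t+excess : ∀ {m} (π : Permutation′ (suc m)) (f : Fin (suc m) → ℕ) t →
  second f ≤ t + sum (λ j → f (π ⟨$⟩ʳ suc j) ∸ t)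
second≤t+excess π f t with second-attained-off f (π ⟨$⟩ʳ zero)
... | inj₁ second≡0 = ≤-trans (≤-reflexive second≡0) z≤n
... | inj₂ (d , d≢π0 , second≤fd) with suc-preimage π d≢π0
...   | j , refl = begin
  second f                                   ≤⟨ second≤fd ⟩
  f (π ⟨$⟩ʳ suc j)                           ≤⟨ m≤n+m∸n _ t ⟩
  t + (f (π ⟨$⟩ʳ suc j) ∸ t)                 ≤⟨ +-monoʳ-≤ t (term≤sum (λ j → f (π ⟨$⟩ʳ suc j) ∸ t) j) ⟩
  t + sum (λ j → f (π ⟨$⟩ʳ suc j) ∸ t)       ∎
  where open ≤-Reasoning

fair-row-bound : ∀ {m} (π : Permutation′ (suc m)) (f : Fin (suc m) → ℕ) {ℓ} → mov f ≤ ℓ → ∀ t →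
  f (π ⟨$⟩ʳ zero) ≤ (ℓ + t) + sum (λ j → f (π ⟨$⟩ʳ suc j) ∸ t)
fair-row-bound π f {ℓ} fair t = begin
  f (π ⟨$⟩ʳ zero)                                  ≤⟨ ≤top f _ ⟩
  top f                                            ≤⟨ top≤second+ℓ f fair ⟩
  second f + ℓ                                     ≤⟨ +-monoˡ-≤ ℓ (second≤t+excess π f t) ⟩
  (t + sum (λ j → f (π ⟨$⟩ʳ suc j) ∸ t)) + ℓ       ≡⟨ solve 3 (λ t s ℓ → (t :+ s) :+ ℓ := (ℓ :+ t) :+ s) refl t _ ℓ ⟩
  (ℓ + t) + sum (λ j → f (π ⟨$⟩ʳ suc j) ∸ t)       ∎
  where open ≤-Reasoning
        open +-*-Solver

fair-matrix-bound : ∀ {k m} (π : Permutation′ (suc m)) (N : Matrix k (suc m)) {ℓ} → HasFairRows ℓ N → ∀ t →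
  sum (λ v → N v (π ⟨$⟩ʳ zero)) ≤ k * (ℓ + t) + sum (λ j → sum (λ v → N v (π ⟨$⟩ʳ suc j)) ∸ t)
fair-matrix-bound {k} π N {ℓ} fair t = begin
  sum (λ v → N v (π ⟨$⟩ʳ zero))                                  ≤⟨ sum-mono-≤ (λ v → fair-row-bound π (N v) (fair v) t) ⟩
  sum (λ v → (ℓ + t) + sum (λ j → N v (π ⟨$⟩ʳ suc j) ∸ t))       ≡⟨ ∑-distrib-+ (λ _ → ℓ + t) (λ v → sum (λ j → N v (π ⟨$⟩ʳ suc j) ∸ t)) ⟩
  sum {k} (λ _ → ℓ + t) + sum (λ v → sum (λ j → N v (π ⟨$⟩ʳ suc j) ∸ t))
                                                    ≡⟨ cong₂ _+_ (sum-const k (ℓ + t)) (∑-comm (λ v j → N v (π ⟨$⟩ʳ suc j) ∸ t)) ⟩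
  k * (ℓ + t) + sum (λ j → sum (λ v → N v (π ⟨$⟩ʳ suc j) ∸ t))   ≤⟨ +-monoʳ-≤ (k * (ℓ + t))
                                                                       (sum-mono-≤ (λ j → sum-∸-const (λ v → N v (π ⟨$⟩ʳ suc j)) t)) ⟩
  k * (ℓ + t) + sum (λ j → sum (λ v → N v (π ⟨$⟩ʳ suc j)) ∸ t)   ∎
  where open ≤-Reasoning

fairMatrix⇒FairCond : ∀ {n k m} ℓ (col : Fin n → Fin m) (π : Permutation′ m) → IsSortedBySize col π →
  (N : Matrix k m) → IsFairMatrix col ℓ N → FairCond col (π ⟨$⟩ʳ_) ℓ k
fairMatrix⇒FairCond {m = zero} ℓ col π sorted N _ =
  ≤-trans (≤-reflexive (SortedSizes.size-beyond col π sorted 0 z≤n)) z≤n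
fairMatrix⇒FairCond {k = k} {m = suc m′} ℓ col π sorted N fair = begin
  size 0                                                       ≡⟨ size-rank zero ⟩
  countU col (π ⟨$⟩ʳ zero)                                     ≡⟨ sym (columnSums _) ⟩
  sum (λ v → N v (π ⟨$⟩ʳ zero))                                ≤⟨ fair-matrix-bound π N fairRows t ⟩
  k * (ℓ + t) + sum (λ j → sum (λ v → N v (π ⟨$⟩ʳ suc j)) ∸ t) ≡⟨ cong (k * (ℓ + t) +_) excess-ranked ⟩
  k * (ℓ + t) + sumTo excess m′                                ≤⟨ +-monoʳ-≤ (k * (ℓ + t)) (sumTo-≤-support excess k excess-vanishes m′) ⟩
  k * (ℓ + t) + sumTo excess k                                 ≡⟨ solve 4 (λ k ℓ t s → k :* (ℓ :+ t) :+ s := ℓ :* k :+ (k :* t :+ s)) refl k ℓ t _ ⟩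
  ℓ * k + (k * t + sumTo excess k)                             ≡⟨ cong (ℓ * k +_) (sumTo-∸ size t k (λ i i≤k → size-antitone (s≤s i≤k))) ⟩
  ℓ * k + sumTo size k                                         ∎
  where
  open ≤-Reasoning
  open +-*-Solver
  open SortedSizes col π sorted
  open IsFairMatrix fair
  t : ℕ
  t = size (suc k)
  excess : ℕ → ℕ
  excess i = size i ∸ t
  excess-vanishes : ∀ i → k < i → excess i ≡ 0
  excess-vanishes i k<i = m≤n⇒m∸n≡0 (size-antitone k<i)
  excess-ranked : sum (λ j → sum (λ v → N v (π ⟨$⟩ʳ suc j)) ∸ t) ≡ sumTo excess m′
  excess-ranked = trans (sum-cong-≗ (λ j → cong (_∸ t) (trans (columnSums _) (sym (size-rank (suc j))))))
                        (sym (sumTo-sum m′ excess))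

telescope : ∀ (d r : ℕ → ℕ) → (∀ s → d s + r (suc s) ≡ r s) → ∀ K → sum {K} (λ v → d (toℕ v)) + r K ≡ r 0
telescope d r step zero = refl
telescope d r step (suc K) = begin
  (d 0 + sum {K} (λ v → d (suc (toℕ v)))) + r (suc K) ≡⟨ +-assoc (d 0) _ _ ⟩
  d 0 + (sum {K} (λ v → d (suc (toℕ v))) + r (suc K)) ≡⟨ cong (d 0 +_) (telescope (λ s → d (suc s)) (λ s → r (suc s)) (λ s → step (suc s)) K) ⟩
  d 0 + r 1                                           ≡⟨ step 0 ⟩
  r 0                                                 ∎
  where open ≡-Reasoning

sum-≤-point : ∀ K (h : ℕ → ℕ) j → (∀ s → s ≢ j → h s ≡ 0) → sum {K} (λ w → h (toℕ w)) ≤ h j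
sum-≤-point zero h j _ = z≤n
sum-≤-point (suc K) h zero off = ≤-reflexive (begin
  h 0 + sum {K} (λ w → h (suc (toℕ w))) ≡⟨ cong (h 0 +_) (sum-cong-≗ {K} (λ w → off (suc (toℕ w)) (λ ()))) ⟩
  h 0 + sum {K} (λ _ → 0)                ≡⟨ cong (h 0 +_) (sum-replicate-zero K) ⟩
  h 0 + 0                                ≡⟨ +-identityʳ (h 0) ⟩
  h 0                                    ∎)
  where open ≡-Reasoning
sum-≤-point (suc K) h (suc j) off = begin
  h 0 + sum {K} (λ w → h (suc (toℕ w))) ≡⟨ cong (_+ sum {K} (λ w → h (suc (toℕ w)))) (off 0 (λ ())) ⟩
  sum {K} (λ w → h (suc (toℕ w)))       ≤⟨ sum-≤-point K (λ s → h (suc s)) j (λ s s≢j → off (suc s) (λ e → s≢j (NatP.suc-injective e))) ⟩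
  h (suc j)                             ∎
  where open ≤-Reasoning

mov-≤-two-level : ∀ {m} (π : Permutation′ (suc m)) (g : Fin (suc m) → ℕ) {ℓ} y →
  y ≤ g zero → g zero ≤ y + ℓ → (∀ j → g (suc j) ≤ y) → (y ≡ 0 ⊎ ∃ λ j → g (suc j) ≡ y) →
  mov (λ c → g (π ⟨$⟩ˡ c)) ≤ ℓ
mov-≤-two-level π g {ℓ} y y≤g₀ g₀≤y+ℓ g≤y (inj₁ refl) = mov-≤-bounded _ (λ c → g≤ℓ (π ⟨$⟩ˡ c))
  where
  g≤ℓ : ∀ r → g r ≤ ℓ
  g≤ℓ zero = g₀≤y+ℓ
  g≤ℓ (suc j) = ≤-trans (g≤y j) z≤n
mov-≤-two-level π g {ℓ} y y≤g₀ g₀≤y+ℓ g≤y (inj₂ (j , gj≡y)) =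
  mov-≤-runnerUp (λ c → g (π ⟨$⟩ˡ c)) {p = π ⟨$⟩ʳ zero} {q = π ⟨$⟩ʳ suc j}
    (λ e → 0≢suc (trans (sym (inverseˡ π)) (trans (cong (π ⟨$⟩ˡ_) e) (inverseˡ π))))
    (subst₂ _≤_ (cong g (sym (inverseˡ π))) (cong g (sym (inverseˡ π))) (subst (_≤ g zero) (sym gj≡y) y≤g₀))
    (λ c → subst (λ x → g (π ⟨$⟩ˡ c) ≤ x + ℓ) (trans (sym gj≡y) (cong g (sym (inverseˡ π)))) (g≤y+ℓ (π ⟨$⟩ˡ c)))
  where
  0≢suc : zero ≢ suc j
  0≢suc ()
  g≤y+ℓ : ∀ r → g r ≤ y + ℓ
  g≤y+ℓ zero = g₀≤y+ℓ
  g≤y+ℓ (suc i) = ≤-trans (g≤y i) (m≤m+n y ℓ)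

module Construction {n k′ m′ : ℕ} ℓ (col : Fin n → Fin (suc m′)) (π : Permutation′ (suc m′))
  (sorted : IsSortedBySize col π) (cond : FairCond col (π ⟨$⟩ʳ_) ℓ (suc k′)) where

  open SortedSizes col π sorted

  -- remaining s is what is left of the largest colour after bins 0, …, s − 1; bin s takes share s
  -- of it and partner s items of the colour of rank s + 1, and bin 0 absorbs all other items.
  remaining share partner : ℕ → ℕ
  remaining s = size 0 ∸ (s * ℓ + sumTo size s)
  share s = (ℓ + size (suc s)) ⊓ remaining s
  partner s = size (suc s) ⊓ remaining s

  remaining-suc : ∀ s → remaining (suc s) ≡ remaining s ∸ (ℓ + size (suc s))
  remaining-suc s = begin
    size 0 ∸ ((ℓ + s * ℓ) + (sumTo size s + size (suc s))) ≡⟨ cong (size 0 ∸_) (regroup ℓ (s * ℓ) _ _) ⟩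
    size 0 ∸ ((s * ℓ + sumTo size s) + (ℓ + size (suc s))) ≡⟨ sym (∸-+-assoc (size 0) (s * ℓ + sumTo size s) (ℓ + size (suc s))) ⟩
    remaining s ∸ (ℓ + size (suc s))                       ∎
    where
    open ≡-Reasoning
    regroup : ∀ a b c d → (a + b) + (c + d) ≡ (b + c) + (a + d)
    regroup = solve 4 (λ a b c d → (a :+ b) :+ (c :+ d) := (b :+ c) :+ (a :+ d)) refl
      where open +-*-Solver

  share+remaining : ∀ s → share s + remaining (suc s) ≡ remaining s
  share+remaining s = trans (cong (share s +_) (remaining-suc s)) (m⊓n+n∸m≡n (ℓ + size (suc s)) (remaining s))

  remaining-end : remaining (suc k′) ≡ 0
  remaining-end = m≤n⇒m∸n≡0 (≤-trans cond (≤-reflexive (cong (_+ sumTo size (suc k′)) (*-comm ℓ (suc k′)))))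

  partner≤share : ∀ s → partner s ≤ share s
  partner≤share s = ⊓-monoˡ-≤ (remaining s) (m≤n+m (size (suc s)) ℓ)

  share≤partner+ℓ : ∀ s → share s ≤ partner s + ℓ
  share≤partner+ℓ s = begin
    (ℓ + size (suc s)) ⊓ remaining s        ≤⟨ ⊓-monoʳ-≤ (ℓ + size (suc s)) (m≤n+m (remaining s) ℓ) ⟩
    (ℓ + size (suc s)) ⊓ (ℓ + remaining s)  ≡⟨ sym (+-distribˡ-⊓ ℓ _ _) ⟩
    ℓ + partner s                           ≡⟨ +-comm ℓ (partner s) ⟩
    partner s + ℓ                           ∎
    where open ≤-Reasoning

  size₁≤share₀ : size 1 ≤ share 0
  size₁≤share₀ = ⊓-glb (m≤n+m (size 1) ℓ) (size-antitone {0} {1} z≤n)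

  taken : ℕ → ℕ → ℕ
  taken s j with s ≟ℕ j
  ... | yes _ = partner j
  ... | no _ = 0

  taken-≤ : ∀ s j → taken s j ≤ partner s
  taken-≤ s j with s ≟ℕ j
  ... | yes refl = ≤-refl
  ... | no _ = z≤n

  taken-self : ∀ s → taken s s ≡ partner s
  taken-self s with s ≟ℕ s
  ... | yes _ = refl
  ... | no s≢s = contradiction refl s≢s

  taken-off : ∀ j s → s ≢ j → taken s j ≡ 0
  taken-off j s s≢j with s ≟ℕ j
  ... | yes s≡j = contradiction s≡j s≢j
  ... | no _ = refl

  elsewhere : ℕ → ℕ
  elsewhere j = sum {k′} (λ w → taken (suc (toℕ w)) j)

  elsewhere≤partner : ∀ j → elsewhere j ≤ partner j
  elsewhere≤partner j = ≤-trans (m≤n+m _ (taken 0 j))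
    (≤-trans (sum-≤-point (suc k′) (λ s → taken s j) j (taken-off j)) (taken-≤ j j))

  R : Matrix (suc k′) (suc m′)
  R v zero = share (toℕ v)
  R zero (suc j) = size (suc (toℕ j)) ∸ elsewhere (toℕ j)
  R (suc w) (suc j) = taken (suc (toℕ w)) (toℕ j)

  R-columnSums : ∀ r → sum (λ v → R v r) ≡ size (toℕ r)
  R-columnSums zero = begin
    sum {suc k′} (λ v → share (toℕ v))                         ≡⟨ sym (+-identityʳ _) ⟩
    sum {suc k′} (λ v → share (toℕ v)) + 0                     ≡⟨ cong (sum {suc k′} (λ v → share (toℕ v)) +_) (sym remaining-end) ⟩
    sum {suc k′} (λ v → share (toℕ v)) + remaining (suc k′)    ≡⟨ telescope share remaining share+remaining (suc k′) ⟩
    size 0                                                     ∎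
    where open ≡-Reasoning
  R-columnSums (suc j) = m∸n+n≡m (≤-trans (elsewhere≤partner (toℕ j)) (m⊓n≤m _ (remaining (toℕ j))))

  N : Matrix (suc k′) (suc m′)
  N v c = R v (π ⟨$⟩ˡ c)

  N-columnSums : HasColumnSums col N
  N-columnSums c = trans (R-columnSums (π ⟨$⟩ˡ c)) (countU-π⁻¹ c)

  N-fairRows : HasFairRows ℓ N
  N-fairRows zero = mov-≤-two-level π (R zero) (size 1) size₁≤share₀
    (≤-trans (m⊓n≤m _ _) (≤-reflexive (+-comm ℓ (size 1))))
    (λ j → ≤-trans (m∸n≤m (size (suc (toℕ j))) (elsewhere (toℕ j))) (size-antitone {1} (s≤s z≤n)))
    size₁-attained
    where
    elsewhere₀ : elsewhere 0 ≡ 0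
    elsewhere₀ = trans (sum-cong-≗ {k′} (λ w → taken-off 0 (suc (toℕ w)) (λ ()))) (sum-replicate-zero k′)
    size₁-attained : size 1 ≡ 0 ⊎ ∃ λ j → R zero (suc j) ≡ size 1
    size₁-attained with 0 <? m′
    ... | no 0≮m′ = inj₁ (size-beyond 1 (s≤s (≮⇒≥ 0≮m′)))
    ... | yes 0<m′ = inj₂ (fromℕ< 0<m′ , trans (cong (λ j → size (suc j) ∸ elsewhere j) (toℕ-fromℕ< 0<m′))
                                               (cong (size 1 ∸_) elsewhere₀))
  N-fairRows (suc w) = mov-≤-two-level π (R (suc w)) (partner s) (partner≤share s) (share≤partner+ℓ s)
    (λ j → taken-≤ s (toℕ j)) partner-attained
    where
    s = suc (toℕ w)
    partner-attained : partner s ≡ 0 ⊎ ∃ λ j → R (suc w) (suc j) ≡ partner s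
    partner-attained with s <? m′
    ... | no s≮m′ = inj₁ (cong (_⊓ remaining s) (size-beyond (suc s) (s≤s (≮⇒≥ s≮m′))))
    ... | yes s<m′ = inj₂ (fromℕ< s<m′ , trans (cong (taken s) (toℕ-fromℕ< s<m′)) (taken-self s))

FairCond⇒fairMatrix : ∀ {n k m} ℓ (col : Fin n → Fin m) (π : Permutation′ m) → IsSortedBySize col π →
  FairCond col (π ⟨$⟩ʳ_) ℓ k → ∃ λ (N : Matrix k m) → IsFairMatrix col ℓ N
FairCond⇒fairMatrix {m = zero} ℓ col π sorted cond = (λ _ ()) , record { columnSums = λ () ; fairRows = λ _ → z≤n }
FairCond⇒fairMatrix {k = zero} {suc m′} ℓ col π sorted cond =
  (λ ()) , record { columnSums = λ c → sym (noItems c) ; fairRows = λ () }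
  where
  open SortedSizes col π sorted
  noItems : ∀ c → countU col c ≡ 0
  noItems c = n≤0⇒n≡0 (begin
    countU col c               ≡⟨ sym (countU-π⁻¹ c) ⟩
    size (toℕ (π ⟨$⟩ˡ c))      ≤⟨ size-antitone {0} {toℕ (π ⟨$⟩ˡ c)} z≤n ⟩
    size 0                     ≤⟨ cond ⟩
    ℓ * 0 + 0                  ≡⟨ cong (_+ 0) (*-zeroʳ ℓ) ⟩
    0                          ∎)
    where open ≤-Reasoning
FairCond⇒fairMatrix {k = suc k′} {suc m′} ℓ col π sorted cond =
  N , record { columnSums = N-columnSums ; fairRows = N-fairRows }
  where open Construction ℓ col π sorted cond

transfer : ∀ {k m} → Matrix k m → (s w : Fin k) → (Fin m → ℕ) → Matrix k m
transfer N s w e v c = (N v c + [ w ↦ e c ] v) ∸ [ s ↦ e c ] v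

module _ {k m : ℕ} (N : Matrix k m) {s w : Fin k} (s≢w : s ≢ w) (e : Fin m → ℕ) where

  transfer-target : ∀ c → transfer N s w e w c ≡ N w c + e c
  transfer-target c = cong₂ _∸_ (cong (N w c +_) ([↦]-self w (e c))) ([↦]-≢ (e c) s≢w)

  transfer-source : ∀ c → transfer N s w e s c ≡ N s c ∸ e c
  transfer-source c = cong₂ _∸_ (trans (cong (N s c +_) ([↦]-≢ (e c) (λ w≡s → s≢w (sym w≡s)))) (+-identityʳ _))
                                ([↦]-self s (e c))

  transfer-other : ∀ {v} → v ≢ s → v ≢ w → ∀ c → transfer N s w e v c ≡ N v c
  transfer-other v≢s v≢w c = cong₂ _∸_ (trans (cong (N _ c +_) ([↦]-≢ (e c) (λ w≡v → v≢w (sym w≡v)))) (+-identityʳ _))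
                                       ([↦]-≢ (e c) (λ s≡v → v≢s (sym s≡v)))

  transfer-columnSums : (∀ c → e c ≤ N s c) → ∀ c → sum (λ v → transfer N s w e v c) ≡ sum (λ v → N v c)
  transfer-columnSums e≤Ns c = begin
    sum (λ v → transfer N s w e v c)                          ≡⟨ sym (m+n∸n≡m _ (sum [ s ↦ e c ])) ⟩
    sum (λ v → transfer N s w e v c) + sum [ s ↦ e c ] ∸ sum [ s ↦ e c ]
                                                              ≡⟨ cong₂ _∸_ (sum-∸ (λ v → N v c + [ w ↦ e c ] v) _ removable) (sum-[↦] s (e c)) ⟩
    sum (λ v → N v c + [ w ↦ e c ] v) ∸ e c                  ≡⟨ cong (_∸ e c) (trans (∑-distrib-+ (λ v → N v c) _) (cong (sum (λ v → N v c) +_) (sum-[↦] w (e c)))) ⟩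
    sum (λ v → N v c) + e c ∸ e c                            ≡⟨ m+n∸n≡m _ (e c) ⟩
    sum (λ v → N v c)                                         ∎
    where
    open ≡-Reasoning
    removable : ∀ v → [ s ↦ e c ] v ≤ N v c + [ w ↦ e c ] v
    removable v with s ≟ v
    ... | yes refl = ≤-trans (e≤Ns c) (m≤m+n _ _)
    ... | no _ = z≤n

record Donation {m} (ℓ : ℕ) (f e : Fin m → ℕ) : Set where
  field
    e≤f : ∀ c → e c ≤ f c
    rest-fair : mov (λ c → f c ∸ e c) ≤ ℓ
    rest-nonempty : 1 ≤ sum (λ c → f c ∸ e c)

module Filling {n k m : ℕ} (col : Fin n → Fin m) (ℓ : ℕ) where

  Fills : Matrix k m → Fin k → Set
  Fills N w = ∃ λ N′ → IsFairMatrix col ℓ N′ × 1 ≤ sum (N′ w) × (∀ v → 1 ≤ sum (N v) → 1 ≤ sum (N′ v))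

  CanFill : Set
  CanFill = ∀ {N} → IsFairMatrix col ℓ N → ∀ {w} → sum (N w) ≡ 0 → Fills N w

  fills-by-rows : ∀ {N} {w} → IsFairMatrix col ℓ N → (N′ : Matrix k m) → HasColumnSums col N′ →
    (∀ v → (∀ c → N′ v c ≡ N v c) ⊎ (mov (N′ v) ≤ ℓ × 1 ≤ sum (N′ v))) → 1 ≤ sum (N′ w) → Fills N w
  fills-by-rows {N} fair N′ colSums rows 1≤N′w = N′ , record { columnSums = colSums ; fairRows = fairRows′ } , 1≤N′w , keeps
    where
    fairRows′ : HasFairRows ℓ N′
    fairRows′ v with rows v
    ... | inj₁ same = ≤-trans (≤-reflexive (mov-cong same)) (IsFairMatrix.fairRows fair v)
    ... | inj₂ (fairv , _) = fairv
    keeps : ∀ v → 1 ≤ sum (N v) → 1 ≤ sum (N′ v)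
    keeps v 1≤Nv with rows v
    ... | inj₁ same = ≤-trans 1≤Nv (≤-reflexive (sym (sum-cong-≗ same)))
    ... | inj₂ (_ , nonempty) = nonempty

  fairNonempty-cong : ∀ {g f : Fin m → ℕ} → (∀ c → g c ≡ f c) → mov f ≤ ℓ → 1 ≤ sum f → mov g ≤ ℓ × 1 ≤ sum g
  fairNonempty-cong g≗f fair-f 1≤f = subst (_≤ ℓ) (sym (mov-cong g≗f)) fair-f , subst (1 ≤_) (sym (sum-cong-≗ g≗f)) 1≤f

  module _ {N : Matrix k m} (fair : IsFairMatrix col ℓ N) {w : Fin k} (empty : sum (N w) ≡ 0) where

    private
      N-w≡0 : ∀ c → N w c ≡ 0
      N-w≡0 c = n≤0⇒n≡0 (≤-trans (term≤sum (N w) c) (≤-reflexive empty))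

      N-columnSums = IsFairMatrix.columnSums fair

    occupied≢empty : ∀ {s} → 1 ≤ sum (N s) → s ≢ w
    occupied≢empty 1≤Ns refl = contradiction (≤-trans 1≤Ns (≤-reflexive empty)) λ ()

    fill-from-one : ∀ {s} → s ≢ w → (e : Fin m → ℕ) → Donation ℓ (N s) e → mov e ≤ ℓ → 1 ≤ sum e → Fills N w
    fill-from-one {s} s≢w e donation fair-e 1≤e = fills-by-rows fair N′
      (λ c → trans (transfer-columnSums N s≢w e e≤f c) (N-columnSums c)) rows (subst (1 ≤_) (sym (sum-cong-≗ N′-w)) 1≤e)
      where
      open Donation donation
      N′ : Matrix k m
      N′ = transfer N s w e
      N′-w : ∀ c → N′ w c ≡ e c
      N′-w c = trans (transfer-target N s≢w e c) (cong (_+ e c) (N-w≡0 c))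
      rows : ∀ v → (∀ c → N′ v c ≡ N v c) ⊎ (mov (N′ v) ≤ ℓ × 1 ≤ sum (N′ v))
      rows v with v ≟ w | v ≟ s
      ... | yes refl | _ = inj₂ (fairNonempty-cong N′-w fair-e 1≤e)
      ... | no _ | yes refl = inj₂ (fairNonempty-cong (transfer-source N s≢w e) rest-fair rest-nonempty)
      ... | no v≢w | no v≢s = inj₁ (transfer-other N s≢w e v≢s v≢w)

    fill-from-two : ∀ {s₁ s₂} → s₁ ≢ w → s₂ ≢ w → s₁ ≢ s₂ → (e₁ e₂ : Fin m → ℕ) →
      Donation ℓ (N s₁) e₁ → Donation ℓ (N s₂) e₂ → mov (λ c → e₁ c + e₂ c) ≤ ℓ → 1 ≤ sum e₁ → Fills N w
    fill-from-two {s₁} {s₂} s₁≢w s₂≢w s₁≢s₂ e₁ e₂ d₁ d₂ fair-e 1≤e₁ = fills-by-rows fair N₂ colSums rows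
      (subst (1 ≤_) (sym (sum-cong-≗ N₂-w)) (≤-trans 1≤e₁ (sum-mono-≤ (λ c → m≤m+n (e₁ c) (e₂ c)))))
      where
      module D₁ = Donation d₁
      module D₂ = Donation d₂
      N₁ N₂ : Matrix k m
      N₁ = transfer N s₁ w e₁
      N₂ = transfer N₁ s₂ w e₂
      s₂≢s₁ : s₂ ≢ s₁
      s₂≢s₁ e = s₁≢s₂ (sym e)
      N₁-s₂ : ∀ c → N₁ s₂ c ≡ N s₂ c
      N₁-s₂ = transfer-other N s₁≢w e₁ s₂≢s₁ s₂≢w
      colSums : HasColumnSums col N₂
      colSums c = trans (transfer-columnSums N₁ s₂≢w e₂ (λ c′ → subst (e₂ c′ ≤_) (sym (N₁-s₂ c′)) (D₂.e≤f c′)) c)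
                        (trans (transfer-columnSums N s₁≢w e₁ D₁.e≤f c) (N-columnSums c))
      N₂-w : ∀ c → N₂ w c ≡ e₁ c + e₂ c
      N₂-w c = trans (transfer-target N₁ s₂≢w e₂ c)
                     (cong (_+ e₂ c) (trans (transfer-target N s₁≢w e₁ c) (cong (_+ e₁ c) (N-w≡0 c))))
      N₂-s₁ : ∀ c → N₂ s₁ c ≡ N s₁ c ∸ e₁ c
      N₂-s₁ c = trans (transfer-other N₁ s₂≢w e₂ s₁≢s₂ s₁≢w c) (transfer-source N s₁≢w e₁ c)
      N₂-s₂ : ∀ c → N₂ s₂ c ≡ N s₂ c ∸ e₂ c
      N₂-s₂ c = trans (transfer-source N₁ s₂≢w e₂ c) (cong (_∸ e₂ c) (N₁-s₂ c))
      rows : ∀ v → (∀ c → N₂ v c ≡ N v c) ⊎ (mov (N₂ v) ≤ ℓ × 1 ≤ sum (N₂ v))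
      rows v with v ≟ w | v ≟ s₁ | v ≟ s₂
      ... | yes refl | _ | _ = inj₂ (fairNonempty-cong N₂-w fair-e (≤-trans 1≤e₁ (sum-mono-≤ (λ c → m≤m+n (e₁ c) (e₂ c)))))
      ... | no _ | yes refl | _ = inj₂ (fairNonempty-cong N₂-s₁ D₁.rest-fair D₁.rest-nonempty)
      ... | no _ | no _ | yes refl = inj₂ (fairNonempty-cong N₂-s₂ D₂.rest-fair D₂.rest-nonempty)
      ... | no v≢w | no v≢s₁ | no v≢s₂ =
        inj₁ (λ c → trans (transfer-other N₁ s₂≢w e₂ v≢s₂ v≢w c) (transfer-other N s₁≢w e₁ v≢s₁ v≢w c))

1≤top : ∀ {m} (f : Fin m → ℕ) → 1 ≤ sum f → 1 ≤ top f
1≤top f 1≤Σf with positive-term f 1≤Σf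
... | c , 1≤fc = ≤-trans 1≤fc (≤top f c)

sum-minus-[↦1] : ∀ {m} (f : Fin m → ℕ) p → 1 ≤ f p → sum (λ c → f c ∸ [ p ↦ 1 ] c) + 1 ≡ sum f
sum-minus-[↦1] f p 1≤fp =
  trans (cong (sum (λ c → f c ∸ [ p ↦ 1 ] c) +_) (sym (sum-[↦] p 1))) (sum-∸ f [ p ↦ 1 ] ([↦]-below p 1≤fp))

-- Either the colour was tied at the top and ends one below it, or it stays the largest
-- colour and only gets closer to the runner-up.
remove-top-item-fair : ∀ {m} (f : Fin (suc m) → ℕ) {ℓ} → 1 ≤ ℓ → mov f ≤ ℓ → 1 ≤ top f →
  mov (λ c → f c ∸ [ TopTwo.argmax f ↦ 1 ] c) ≤ ℓ
remove-top-item-fair {m} f {ℓ} 1≤ℓ fair 1≤top = by-cases second-attained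
  where
  open TopTwo f
  open ≤-Reasoning
  p : Fin (suc m)
  p = argmax
  f′ : Fin (suc m) → ℕ
  f′ c = f c ∸ [ p ↦ 1 ] c
  f′≤top : ∀ c → f′ c ≤ top f
  f′≤top c = ≤-trans (m∸n≤m (f c) ([ p ↦ 1 ] c)) (≤top f c)
  f′-p : f′ p ≡ top f ∸ 1
  f′-p = cong₂ _∸_ f-argmax ([↦]-self p 1)
  f′-other : ∀ {c} → c ≢ p → f′ c ≡ f c
  f′-other c≢p = cong (f _ ∸_) ([↦]-≢ 1 (λ p≡c → c≢p (sym p≡c)))
  by-cases : (second f ≡ 0 ⊎ ∃ λ j → j ≢ p × f j ≡ second f) → mov f′ ≤ ℓ
  by-cases (inj₁ second≡0) =
    mov-≤-bounded f′ (λ c → ≤-trans (f′≤top c) (subst (λ b → top f ≤ b + ℓ) second≡0 (top≤second+ℓ f fair)))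
  by-cases (inj₂ (j , j≢p , fj≡second)) with top f ≤? f j
  ... | yes tie = mov-≤-runnerUp f′ j≢p
    (begin f′ p ≤⟨ f′≤top p ⟩ top f ≤⟨ tie ⟩ f j ≡⟨ sym (f′-other j≢p) ⟩ f′ j ∎)
    (λ c → begin
      f′ c            ≤⟨ f′≤top c ⟩
      top f           ≡⟨ sym (m∸n+n≡m 1≤top) ⟩
      (top f ∸ 1) + 1 ≡⟨ cong (_+ 1) (sym f′-p) ⟩
      f′ p + 1        ≤⟨ +-monoʳ-≤ (f′ p) 1≤ℓ ⟩
      f′ p + ℓ        ∎)
  ... | no untied = mov-≤-runnerUp f′ (λ p≡j → j≢p (sym p≡j))
    (begin
      f′ j          ≡⟨ f′-other j≢p ⟩
      f j           ≤⟨ ≤-pred (≤-trans (≰⇒> untied) (≤-reflexive (sym (trans (+-comm 1 _) (m∸n+n≡m 1≤top))))) ⟩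
      top f ∸ 1     ≡⟨ sym f′-p ⟩
      f′ p          ∎)
    (λ c → begin
      f′ c          ≤⟨ f′≤top c ⟩
      top f         ≤⟨ top≤second+ℓ f fair ⟩
      second f + ℓ  ≡⟨ cong (_+ ℓ) (sym (trans (f′-other j≢p) fj≡second)) ⟩
      f′ j + ℓ      ∎)

donate-top-item : ∀ {m} (f : Fin m → ℕ) {ℓ} → 1 ≤ ℓ → mov f ≤ ℓ → 2 ≤ sum f →
  ∃ λ e → Donation ℓ f e × mov e ≤ ℓ × 1 ≤ sum e
donate-top-item {suc m} f 1≤ℓ fair 2≤Σf =
  [ p ↦ 1 ] , donation , mov-≤-bounded _ (λ c → ≤-trans ([↦]-bounded p c) 1≤ℓ) , ≤-reflexive (sym (sum-[↦] p 1))
  where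
  p : Fin (suc m)
  p = TopTwo.argmax f
  1≤top′ : 1 ≤ top f
  1≤top′ = 1≤top f (≤-trans (s≤s z≤n) 2≤Σf)
  1≤fp : 1 ≤ f p
  1≤fp = subst (1 ≤_) (sym (TopTwo.f-argmax f)) 1≤top′
  donation : Donation _ f [ p ↦ 1 ]
  donation = record
    { e≤f = [↦]-below p 1≤fp
    ; rest-fair = remove-top-item-fair f 1≤ℓ fair 1≤top′
    ; rest-nonempty = +-cancelʳ-≤ 1 1 _ (subst (2 ≤_) (sym (sum-minus-[↦1] f p 1≤fp)) 2≤Σf)
    }

tied : ∀ {m} (f : Fin m → ℕ) → mov f ≤ 0 → top f ≤ second f
tied f fair = ≤-trans (top≤second+ℓ f fair) (≤-reflexive (+-identityʳ _))

tied-nonempty⇒2≤ : ∀ {m} (f : Fin m → ℕ) → mov f ≤ 0 → 1 ≤ sum f → 2 ≤ sum f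
tied-nonempty⇒2≤ f fair 1≤Σf = ≤-trans (+-mono-≤ 1≤t (≤-trans 1≤t (tied f fair))) (top+second≤sum f)
  where 1≤t = 1≤top f 1≤Σf

tied-small⇒binary : ∀ {m} (f : Fin m → ℕ) → mov f ≤ 0 → sum f ≤ 3 → ∀ c → f c ≤ 1
tied-small⇒binary f fair Σf≤3 c with top f ≤? 1
... | yes top≤1 = ≤-trans (≤top f c) top≤1
... | no top≰1 = contradiction (≤-trans (+-mono-≤ 2≤t (≤-trans 2≤t (tied f fair))) (top+second≤sum f)) (<⇒≱ (s≤s Σf≤3))
  where 2≤t = ≰⇒> top≰1

tied-top-pair : ∀ {m} (f : Fin m → ℕ) → mov f ≤ 0 → 1 ≤ top f → ∃₂ λ p q → p ≢ q × f p ≡ top f × f q ≡ top f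
tied-top-pair {suc m} f fair 1≤t with TopTwo.second-attained f
... | inj₁ second≡0 = contradiction (≤-trans 1≤t (≤-trans (tied f fair) (≤-reflexive second≡0))) λ ()
... | inj₂ (q , q≢p , fq≡second) =
  TopTwo.argmax f , q , (λ p≡q → q≢p (sym p≡q)) , TopTwo.f-argmax f
  , trans fq≡second (≤-antisym (second≤top f) (tied f fair))

binary-mov≤0 : ∀ {m} (f : Fin m → ℕ) → (∀ c → f c ≤ 1) → 2 ≤ sum f → mov f ≤ 0
binary-mov≤0 f f≤1 2≤Σf with two-ones f f≤1 2≤Σf
... | p , q , p≢q , fp≡1 , fq≡1 = mov-≤-runnerUp f p≢q (≤-reflexive (trans fq≡1 (sym fp≡1)))
  (λ c → ≤-trans (f≤1 c) (≤-reflexive (sym (trans (+-identityʳ _) fq≡1))))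

binary-donation : ∀ {m} (f e : Fin m → ℕ) → (∀ c → f c ≤ 1) → (∀ c → e c ≤ f c) → sum e + 2 ≤ sum f → Donation 0 f e
binary-donation {m} f e f≤1 e≤f Σe+2≤Σf = record
  { e≤f = e≤f ; rest-fair = binary-mov≤0 rest (λ c → ≤-trans (m∸n≤m (f c) (e c)) (f≤1 c)) 2≤rest
  ; rest-nonempty = ≤-trans (s≤s z≤n) 2≤rest }
  where
  rest : Fin m → ℕ
  rest c = f c ∸ e c
  2≤rest : 2 ≤ sum rest
  2≤rest = +-cancelˡ-≤ (sum e) 2 (sum rest)
    (≤-trans Σe+2≤Σf (≤-reflexive (trans (sym (sum-∸ f e e≤f)) (+-comm (sum rest) (sum e)))))

pair : ∀ {m} → Fin m → Fin m → Fin m → ℕ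
pair p q c = [ p ↦ 1 ] c + [ q ↦ 1 ] c

module _ {m : ℕ} {p q : Fin m} (p≢q : p ≢ q) where

  pair-binary : ∀ c → pair p q c ≤ 1
  pair-binary c with p ≟ c | q ≟ c
  ... | yes refl | yes refl = contradiction refl p≢q
  ... | yes _ | no _ = ≤-refl
  ... | no _ | yes _ = ≤-refl
  ... | no _ | no _ = z≤n

  sum-pair : sum (pair p q) ≡ 2
  sum-pair = trans (∑-distrib-+ [ p ↦ 1 ] [ q ↦ 1 ]) (cong₂ _+_ (sum-[↦] p 1) (sum-[↦] q 1))

  pair-mov≤0 : mov (pair p q) ≤ 0
  pair-mov≤0 = binary-mov≤0 (pair p q) pair-binary (≤-reflexive (sym sum-pair))

  pair-below : ∀ {f : Fin m → ℕ} → 1 ≤ f p → 1 ≤ f q → ∀ c → pair p q c ≤ f c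
  pair-below {f} 1≤fp 1≤fq c with p ≟ c | q ≟ c
  ... | yes refl | yes refl = contradiction refl p≢q
  ... | yes refl | no _ = subst (_≤ f p) (sym (+-identityʳ 1)) 1≤fp
  ... | no _ | yes refl = 1≤fq
  ... | no _ | no _ = z≤n

-- Every colour at the top level t ≥ 2 gives one item: both the given part and the rest are
-- then tied, at levels 1 and t − 1.
donate-top-level : ∀ {m} (f : Fin m → ℕ) {p q} → p ≢ q → f p ≡ top f → f q ≡ top f → 2 ≤ top f →
  ∃ λ e → Donation 0 f e × mov e ≤ 0 × 1 ≤ sum e
donate-top-level {m} f {p} {q} p≢q fp fq 2≤t =
  atTop , donation , mov-≤-runnerUp atTop p≢q (≤-reflexive (trans (atTop-top fq) (sym (atTop-top fp))))
                       (λ c → ≤-trans (atTop≤1 c) (≤-reflexive (sym (cong (_+ 0) (atTop-top fq)))))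
  , ≤-trans (≤-reflexive (sym (atTop-top fp))) (term≤sum atTop p)
  where
  t : ℕ
  t = top f
  atTop : Fin m → ℕ
  atTop c with f c ≟ℕ t
  ... | yes _ = 1
  ... | no _ = 0
  atTop-top : ∀ {c} → f c ≡ t → atTop c ≡ 1
  atTop-top {c} fc≡t with f c ≟ℕ t
  ... | yes _ = refl
  ... | no fc≢t = contradiction fc≡t fc≢t
  atTop≤1 : ∀ c → atTop c ≤ 1
  atTop≤1 c with f c ≟ℕ t
  ... | yes _ = ≤-refl
  ... | no _ = z≤n
  atTop≤f : ∀ c → atTop c ≤ f c
  atTop≤f c with f c ≟ℕ t
  ... | yes fc≡t = ≤-trans (s≤s z≤n) (≤-trans 2≤t (≤-reflexive (sym fc≡t)))
  ... | no _ = z≤n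
  rest : Fin m → ℕ
  rest c = f c ∸ atTop c
  rest≤t-1 : ∀ c → rest c ≤ t ∸ 1
  rest≤t-1 c with f c ≟ℕ t
  ... | yes fc≡t = ≤-reflexive (cong (_∸ 1) fc≡t)
  ... | no fc≢t = ≤-pred (≤-trans (≤∧≢⇒< (≤top f c) fc≢t) (≤-reflexive (sym (trans (+-comm 1 _) (m∸n+n≡m (≤-trans (s≤s z≤n) 2≤t))))))
  rest-top : ∀ {c} → f c ≡ t → rest c ≡ t ∸ 1
  rest-top fc≡t = cong₂ _∸_ fc≡t (atTop-top fc≡t)
  donation : Donation 0 f atTop
  donation = record
    { e≤f = atTop≤f
    ; rest-fair = mov-≤-runnerUp rest p≢q (≤-reflexive (trans (rest-top fq) (sym (rest-top fp))))
                    (λ c → ≤-trans (rest≤t-1 c) (≤-reflexive (sym (trans (+-identityʳ _) (rest-top fq)))))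
    ; rest-nonempty = ≤-trans (≤-trans (∸-monoˡ-≤ 1 2≤t) (≤-reflexive (sym (rest-top fp)))) (term≤sum rest p)
    }

donate-pair : ∀ {m} (f : Fin m → ℕ) {p q} → p ≢ q → 1 ≤ f p → 1 ≤ f q → (∀ c → f c ≤ 1) → 4 ≤ sum f →
  ∃ λ e → Donation 0 f e × mov e ≤ 0 × 1 ≤ sum e
donate-pair f {p} {q} p≢q 1≤fp 1≤fq f≤1 4≤Σf =
  pair p q
  , binary-donation f (pair p q) f≤1 (pair-below p≢q 1≤fp 1≤fq) (subst (λ x → x + 2 ≤ sum f) (sym (sum-pair p≢q)) 4≤Σf)
  , pair-mov≤0 p≢q , ≤-trans (s≤s z≤n) (≤-reflexive (sym (sum-pair p≢q)))

split-large-tied-row : ∀ {m} (f : Fin m → ℕ) → mov f ≤ 0 → 4 ≤ sum f → ∃ λ e → Donation 0 f e × mov e ≤ 0 × 1 ≤ sum e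
split-large-tied-row f fair 4≤Σf = by-level (tied-top-pair f fair 1≤t) (2 ≤? top f)
  where
  1≤t : 1 ≤ top f
  1≤t = 1≤top f (≤-trans (s≤s z≤n) 4≤Σf)
  by-level : (∃₂ λ p q → p ≢ q × f p ≡ top f × f q ≡ top f) → Dec (2 ≤ top f) →
    ∃ λ e → Donation 0 f e × mov e ≤ 0 × 1 ≤ sum e
  by-level (p , q , p≢q , fp , fq) (yes 2≤t) = donate-top-level f p≢q fp fq 2≤t
  by-level (p , q , p≢q , fp , fq) (no t≱2) =
    donate-pair f p≢q (subst (1 ≤_) (sym fp) 1≤t) (subst (1 ≤_) (sym fq) 1≤t)
      (λ c → ≤-trans (≤top f c) (≤-pred (≰⇒> t≱2))) 4≤Σf

sum+b≤k*b : ∀ {k} (f : Fin k → ℕ) {w} b → f w ≡ 0 → (∀ v → f v ≤ b) → sum f + b ≤ k * b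
sum+b≤k*b {k} f {w} b fw≡0 f≤b = begin
  sum f + b                      ≡⟨ cong (sum f +_) (sym (sum-[↦] w b)) ⟩
  sum f + sum [ w ↦ b ]          ≡⟨ sym (∑-distrib-+ f [ w ↦ b ]) ⟩
  sum (λ v → f v + [ w ↦ b ] v)  ≤⟨ sum-mono-≤ term≤b ⟩
  sum {k} (λ _ → b)              ≡⟨ sum-const k b ⟩
  k * b                          ∎
  where
  open ≤-Reasoning
  term≤b : ∀ v → f v + [ w ↦ b ] v ≤ b
  term≤b v with w ≟ v
  ... | yes refl = ≤-reflexive (cong (_+ b) fw≡0)
  ... | no _ = ≤-trans (≤-reflexive (+-identityʳ _)) (f≤b v)

sum≤1-of-unique-one : ∀ {k} (f : Fin k → ℕ) → (∀ v → f v ≤ 1) → (∀ {v₁ v₂} → f v₁ ≡ 1 → f v₂ ≡ 1 → v₁ ≡ v₂) → sum f ≤ 1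
sum≤1-of-unique-one f f≤1 unique with 2 ≤? sum f
... | no 2≰Σf = ≤-pred (≰⇒> 2≰Σf)
... | yes 2≤Σf with two-ones f f≤1 2≤Σf
...   | p , q , p≢q , fp≡1 , fq≡1 = contradiction (unique fp≡1 fq≡1) p≢q

sum<2k : ∀ {k} (r : Fin k → ℕ) {w} → r w ≡ 0 → (∀ v → r v ≤ 3) →
  (∀ {v₁ v₂} → 3 ≤ r v₁ → 3 ≤ r v₂ → v₁ ≡ v₂) → sum r < 2 * k
sum<2k {k} r {w} rw≡0 r≤3 unique =
  +-cancelʳ-≤ 1 (suc (sum r)) (2 * k) (subst (_≤ 2 * k + 1) (+-suc (sum r) 1) (begin
  sum r + 2                            ≡⟨ cong (_+ 2) (trans (sum-cong-≗ split) (∑-distrib-+ low high)) ⟩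
  (sum low + sum high) + 2             ≡⟨ solve 2 (λ a b → (a :+ b) :+ con 2 := (a :+ con 2) :+ b) refl (sum low) (sum high) ⟩
  (sum low + 2) + sum high             ≤⟨ +-mono-≤ (sum+b≤k*b low 2 (cong (2 ⊓_) rw≡0) (λ v → m⊓n≤m 2 (r v)))
                                                   (sum≤1-of-unique-one high high≤1 (λ h₁ h₂ → unique (3≤ h₁) (3≤ h₂))) ⟩
  k * 2 + 1                            ≡⟨ cong (_+ 1) (*-comm k 2) ⟩
  2 * k + 1                            ∎))
  where
  open ≤-Reasoning
  open +-*-Solver
  low high : Fin k → ℕ
  low v = 2 ⊓ r v
  high v = r v ∸ 2
  split : ∀ v → r v ≡ low v + high v
  split v = sym (m⊓n+n∸m≡n 2 (r v))
  high≤1 : ∀ v → high v ≤ 1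
  high≤1 v = ∸-monoˡ-≤ 2 (r≤3 v)
  3≤ : ∀ {v} → high v ≡ 1 → 3 ≤ r v
  3≤ {v} high≡1 = ∸-cancelʳ-< (subst₂ _<_ (sym (n∸n≡0 (r v))) (sym high≡1) z<s)

module _ {n k m : ℕ} (col : Fin n → Fin m) where

  fill-step-positive : ∀ {ℓ} → 1 ≤ ℓ → k ≤ n → Filling.CanFill {k = k} col ℓ
  fill-step-positive {ℓ} 1≤ℓ k≤n {N} fair {w} empty with any? (λ v → 2 ≤? sum (N v))
  ... | yes (s , 2≤Ns) with donate-top-item (N s) 1≤ℓ (IsFairMatrix.fairRows fair s) 2≤Ns
  ...   | e , donation , fair-e , 1≤e =
    fill-from-one fair empty (occupied≢empty fair empty (≤-trans (s≤s z≤n) 2≤Ns)) e donation fair-e 1≤e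
    where open Filling {k = k} col ℓ
  fill-step-positive {ℓ} 1≤ℓ k≤n {N} fair {w} empty | no none = contradiction k≤n (<⇒≱ (begin
    suc n                           ≡⟨ cong suc (sym (entries-total N (IsFairMatrix.columnSums fair))) ⟩
    suc (sum (λ v → sum (N v)))     ≡⟨ +-comm 1 _ ⟩
    sum (λ v → sum (N v)) + 1       ≤⟨ sum+b≤k*b (λ v → sum (N v)) 1 empty (λ v → ≤-pred (≰⇒> (λ 2≤Nv → none (v , 2≤Nv)))) ⟩
    k * 1                           ≡⟨ *-identityʳ k ⟩
    k                               ∎))
    where open ≤-Reasoning

  module _ {N : Matrix k m} (fair : IsFairMatrix col 0 N) {w : Fin k} (empty : sum (N w) ≡ 0) (≤3 : ∀ v → sum (N v) ≤ 3) where
    open Filling {k = k} col 0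

    fill-from-triples : ∀ {v₁ v₂} → v₁ ≢ v₂ → 3 ≤ sum (N v₁) → 3 ≤ sum (N v₂) → Fills N w
    fill-from-triples {v₁} {v₂} v₁≢v₂ 3≤N₁ 3≤N₂ = fill (positive-term (N v₁) (≤-trans (s≤s z≤n) 3≤N₁))
      where
      binary : ∀ v → ∀ c → N v c ≤ 1
      binary v = tied-small⇒binary (N v) (IsFairMatrix.fairRows fair v) (≤3 v)
      give-one : ∀ {v} → 3 ≤ sum (N v) → ∀ c → 1 ≤ N v c → Donation 0 (N v) [ c ↦ 1 ]
      give-one {v} 3≤Nv c 1≤Nvc = binary-donation (N v) [ c ↦ 1 ] (binary v) ([↦]-below c 1≤Nvc)
        (subst (λ x → x + 2 ≤ sum (N v)) (sym (sum-[↦] c 1)) 3≤Nv)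
      other-colour : ∀ c → ∃ λ x → c ≢ x × 1 ≤ N v₂ x
      other-colour c with two-ones (N v₂) (binary v₂) (≤-trans (s≤s (s≤s z≤n)) 3≤N₂)
      ... | p , q , p≢q , Np≡1 , Nq≡1 with p ≟ c
      ...   | yes refl = q , p≢q , ≤-reflexive (sym Nq≡1)
      ...   | no p≢c = p , (λ c≡p → p≢c (sym c≡p)) , ≤-reflexive (sym Np≡1)
      fill : (∃ λ c → 1 ≤ N v₁ c) → Fills N w
      fill (c , 1≤N₁c) with other-colour c
      ... | x , c≢x , 1≤N₂x = fill-from-two fair empty (occupied≢empty fair empty (≤-trans (s≤s z≤n) 3≤N₁))
        (occupied≢empty fair empty (≤-trans (s≤s z≤n) 3≤N₂)) v₁≢v₂ [ c ↦ 1 ] [ x ↦ 1 ]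
        (give-one 3≤N₁ c 1≤N₁c) (give-one 3≤N₂ x 1≤N₂x) (pair-mov≤0 c≢x) (≤-reflexive (sym (sum-[↦] c 1)))

    fill-from-small-rows : 2 * k ≤ n → Fills N w
    fill-from-small-rows 2k≤n with any? (λ v₁ → (3 ≤? sum (N v₁)) ×-dec any? (λ v₂ → (3 ≤? sum (N v₂)) ×-dec ¬? (v₂ ≟ v₁)))
    ... | yes (v₁ , 3≤N₁ , v₂ , 3≤N₂ , v₂≢v₁) = fill-from-triples (λ v₁≡v₂ → v₂≢v₁ (sym v₁≡v₂)) 3≤N₁ 3≤N₂
    ... | no noPair = contradiction 2k≤n (<⇒≱ (subst (_< 2 * k) (entries-total N (IsFairMatrix.columnSums fair))
                                                (sum<2k (λ v → sum (N v)) empty ≤3 unique)))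
      where
      unique : ∀ {v₁ v₂} → 3 ≤ sum (N v₁) → 3 ≤ sum (N v₂) → v₁ ≡ v₂
      unique {v₁} {v₂} 3≤N₁ 3≤N₂ with v₂ ≟ v₁
      ... | yes v₂≡v₁ = sym v₂≡v₁
      ... | no v₂≢v₁ = contradiction (v₁ , 3≤N₁ , v₂ , 3≤N₂ , v₂≢v₁) noPair

  fill-step-tied : 2 * k ≤ n → Filling.CanFill {k = k} col 0
  fill-step-tied 2k≤n {N} fair {w} empty with any? (λ v → 4 ≤? sum (N v))
  ... | yes (s , 4≤Ns) with split-large-tied-row (N s) (IsFairMatrix.fairRows fair s) 4≤Ns
  ...   | e , donation , fair-e , 1≤e =
    fill-from-one fair empty (occupied≢empty fair empty (≤-trans (s≤s z≤n) 4≤Ns)) e donation fair-e 1≤e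
    where open Filling {k = k} col 0
  fill-step-tied 2k≤n {N} fair {w} empty | no none₄ =
    fill-from-small-rows fair empty (λ v → ≤-pred (≰⇒> (λ 4≤Nv → none₄ (v , 4≤Nv)))) 2k≤n

  fill-bins : ∀ {ℓ} → Filling.CanFill col ℓ → ∀ {N₀ : Matrix k m} → IsFairMatrix col ℓ N₀ → (vs : List (Fin k)) →
    ∃ λ N → IsFairMatrix col ℓ N × All (λ v → 1 ≤ sum (N v)) vs
  fill-bins step fair₀ [] = _ , fair₀ , []
  fill-bins step fair₀ (w ∷ vs) with fill-bins step fair₀ vs
  ... | N , fair , filled with 1 ≤? sum (N w)
  ...   | yes 1≤Nw = N , fair , 1≤Nw ∷ filled
  ...   | no 1≰Nw with step fair (n<1⇒n≡0 (≰⇒> 1≰Nw))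
  ...     | N′ , fair′ , 1≤N′w , keeps = N′ , fair′ , 1≤N′w ∷ All.map (λ {v} → keeps v) filled

  fill-all-bins : ∀ {ℓ} → Filling.CanFill col ℓ → ∀ {N₀ : Matrix k m} → IsFairMatrix col ℓ N₀ →
    ∃ λ N → IsFairMatrix col ℓ N × (∀ v → 1 ≤ sum (N v))
  fill-all-bins step fair₀ with fill-bins step fair₀ (allFin k)
  ... | N , fair , filled = N , fair , λ v → All.lookup filled (∈-allFin v)

fairAssignment⇒fairMatrix : ∀ {n k m} {ℓ} (σ : Fin n → Fin k) (col : Fin n → Fin m) → IsFair ℓ σ col →
  IsFairMatrix col ℓ (countMc σ col)
fairAssignment⇒fairMatrix {ℓ = ℓ} σ col fair = record
  { columnSums = countMc-columnSums σ col
  ; fairRows = λ v → subst (_≤ ℓ) (MoV≡mov σ col v) (fair v) }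

onto⇒rows-nonempty : ∀ {n k m} (σ : Fin n → Fin k) (col : Fin n → Fin m) → (∀ v → ∃ λ u → σ u ≡ v) →
  ∀ v → 1 ≤ sum (countMc σ col v)
onto⇒rows-nonempty σ col onto v with onto v
... | u , refl = begin
  1                                       ≡⟨ cong ⟦_⟧ (sym (dec-true (σ u ≟ σ u) refl)) ⟩
  ⟦ does (σ u ≟ σ u) ⟧                    ≤⟨ term≤sum (λ u′ → ⟦ does (σ u′ ≟ σ u) ⟧) u ⟩
  sum (λ u′ → ⟦ does (σ u′ ≟ σ u) ⟧)      ≡⟨ sym (countMc-rowSum σ col (σ u)) ⟩
  sum (countMc σ col (σ u))               ∎
  where open ≤-Reasoning

fairMatrix⇒fairAssignment : ∀ {n k m} {ℓ} (col : Fin n → Fin m) (N : Matrix k m) → IsFairMatrix col ℓ N →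
  ∃ λ (σ : Fin n → Fin k) → IsFair ℓ σ col × (∀ v → 1 ≤ sum (N v) → ∃ λ u → σ u ≡ v)
fairMatrix⇒fairAssignment {ℓ = ℓ} col N fair with realise col N (IsFairMatrix.columnSums fair)
... | σ , counts = σ , fair-σ , occupied
  where
  fair-σ : IsFair ℓ σ col
  fair-σ v = subst (_≤ ℓ) (sym (trans (MoV≡mov σ col v) (mov-cong (counts v)))) (IsFairMatrix.fairRows fair v)
  occupied : ∀ v → 1 ≤ sum (N v) → ∃ λ u → σ u ≡ v
  occupied v 1≤Nv with positive-term (λ u → ⟦ does (σ u ≟ v) ⟧)
                         (subst (1 ≤_) (trans (sym (sum-cong-≗ (counts v))) (countMc-rowSum σ col v)) 1≤Nv)
  ... | u , 1≤⟦σu≟v⟧ with σ u ≟ v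
  ...   | yes σu≡v = u , σu≡v

rows-≥⇒k*b≤n : ∀ {n k m} {col : Fin n → Fin m} (N : Matrix k m) → HasColumnSums col N →
  ∀ b → (∀ v → b ≤ sum (N v)) → k * b ≤ n
rows-≥⇒k*b≤n {k = k} N colSums b b≤rows = begin
  k * b                    ≡⟨ sym (sum-const k b) ⟩
  sum {k} (λ _ → b)        ≤⟨ sum-mono-≤ b≤rows ⟩
  sum (λ v → sum (N v))    ≡⟨ entries-total N colSums ⟩
  _                        ∎
  where open ≤-Reasoning

EnoughItems : ℕ → ℕ → ℕ → Set
EnoughItems ℓ k n = (0 < ℓ × k ≤ n) ⊎ (ℓ ≡ 0 × 2 * k ≤ n)

nonemptyFairMatrix⇒enoughItems : ∀ {n k m} {ℓ} {col : Fin n → Fin m} (N : Matrix k m) → IsFairMatrix col ℓ N →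
  (∀ v → 1 ≤ sum (N v)) → EnoughItems ℓ k n
nonemptyFairMatrix⇒enoughItems {n} {ℓ = suc _} N fair nonempty =
  inj₁ (s≤s z≤n , subst (_≤ n) (*-identityʳ _) (rows-≥⇒k*b≤n N (IsFairMatrix.columnSums fair) 1 nonempty))
nonemptyFairMatrix⇒enoughItems {n} {k} {ℓ = zero} N fair nonempty =
  inj₂ (refl , subst (_≤ n) (*-comm k 2) (rows-≥⇒k*b≤n N (IsFairMatrix.columnSums fair) 2
    (λ v → tied-nonempty⇒2≤ (N v) (IsFairMatrix.fairRows fair v) (nonempty v))))

enoughItems⇒canFill : ∀ {n k m} {ℓ} (col : Fin n → Fin m) → EnoughItems ℓ k n →
  Filling.CanFill {k = k} {m} col ℓ
enoughItems⇒canFill col (inj₁ (0<ℓ , k≤n)) = fill-step-positive col 0<ℓ k≤n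
enoughItems⇒canFill col (inj₂ (refl , 2k≤n)) = fill-step-tied col 2k≤n

theorem26 : (n k m ℓ : ℕ) (E : BipGraph n k) → IsCompleteBipartite E →
    (col : Fin n → Fin m) (π : Permutation′ m) →
    ((i j : Fin m) → toℕ j ≡ suc (toℕ i) → countU col (π ⟨$⟩ʳ j) ≤ countU col (π ⟨$⟩ʳ i)) →
    (YesInstance E col ℓ ⇔ FairCond col (π ⟨$⟩ʳ_) ℓ k)
    × (YesInstanceNE E col ℓ ⇔
        (FairCond col (π ⟨$⟩ʳ_) ℓ k × ((0 < ℓ × k ≤ n) ⊎ (ℓ ≡ 0 × 2 * k ≤ n))))
theorem26 n k m ℓ E complete col π sorted = mk⇔ yes⇒cond cond⇒yes , mk⇔ yesNE⇒cond condNE⇒yesNE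
  where
  matching : (Fin n → Fin k) → LeftPerfectMatching E
  matching σ = record { assign = σ ; inE = λ u → complete u (σ u) }
  matrix⇒cond : ∀ {N} → IsFairMatrix col ℓ N → FairCond col (π ⟨$⟩ʳ_) ℓ k
  matrix⇒cond {N} = fairMatrix⇒FairCond ℓ col π sorted N
  yes⇒cond : YesInstance E col ℓ → FairCond col (π ⟨$⟩ʳ_) ℓ k
  yes⇒cond (M , fair) = matrix⇒cond (fairAssignment⇒fairMatrix (assign M) col fair)
  cond⇒yes : FairCond col (π ⟨$⟩ʳ_) ℓ k → YesInstance E col ℓ
  cond⇒yes cond with FairCond⇒fairMatrix ℓ col π sorted cond
  ... | N , fair with fairMatrix⇒fairAssignment col N fair
  ...   | σ , fair-σ , _ = matching σ , fair-σ
  yesNE⇒cond : YesInstanceNE E col ℓ → FairCond col (π ⟨$⟩ʳ_) ℓ k × EnoughItems ℓ k n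
  yesNE⇒cond (M , fair , onto) = matrix⇒cond fair-N , nonemptyFairMatrix⇒enoughItems _ fair-N (onto⇒rows-nonempty (assign M) col onto)
    where fair-N = fairAssignment⇒fairMatrix (assign M) col fair
  condNE⇒yesNE : FairCond col (π ⟨$⟩ʳ_) ℓ k × EnoughItems ℓ k n → YesInstanceNE E col ℓ
  condNE⇒yesNE (cond , enough) with FairCond⇒fairMatrix ℓ col π sorted cond
  ... | N₀ , fair₀ with fill-all-bins col (enoughItems⇒canFill col enough) fair₀
  ...   | N , fair , nonempty with fairMatrix⇒fairAssignment col N fair
  ...     | σ , fair-σ , occupied = matching σ , fair-σ , λ v → occupied v (nonempty v)
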